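{- Let $T_{4,3}$ be the tetriamond consisting of one cell of the triangular tiling together with its three adjacent cells (its union is an equilateral triangle of side length $2$). Then $\tau(T_{4,3})=(0,3,8,\infty)$, i.e. $T_{4,3}$ is a $(1,1)$-loser, a $(2,3)$-winner, a $(2,4)$-loser, a $(3,8)$-winner, a $(3,9)$-loser, and an $(n,b)$-winner for all $n\ge4$ and all $b\ge0$.
   Context: The board is the tiling of the plane by unit equilateral triangles (cells); cells are adjacent if they share an edge. A polyiamond is a finite connected set of cells up to congruence. In the weak $(a,b)$ achievement game ($a\ge1,b\ge0$) for a goal polyiamond $A$ on the infinite board, maker and breaker alternately mark previously unmarked cells, maker first, $a$ resp. $b$ cells per turn; the maker wins if his marked cells at some point contain a set congruent to $A$; $A$ is an $(a,b)$-winner if the maker has a strategy guaranteeing a win in finitely many turns against every breaker play, otherwise an $(a,b)$-loser. The threshold sequence $\tau(A)=(b_1,b_2,\ldots)$ has $b_n$ the greatest $b$ for which $A$ is an $(n,b)$-winner ($\infty$ if for all $b$); $(b_1,\ldots,b_{k-1},\infty)$ denotes the sequence with $b_n=\infty$ for all $n\ge k$. -}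

module Defs where

open import Data.Nat using (ℕ; _<_; _≥_)
open import Data.Integer using (ℤ; +_; -_; _+_; _*_; -[1+_])
open import Data.Bool using (Bool; true; false)
open import Data.Fin using (Fin)
open import Data.Product using (_×_; _,_; Σ; ∃)
open import Data.List using (List; []; _∷_; _++_; length)
open import Data.List.Membership.Propositional using (_∈_; _∉_)
open import Data.List.Relation.Unary.All using (All)
open import Data.List.Relation.Unary.Any using (Any)
open import Data.List.Relation.Unary.Unique.Propositional using (Unique)
open import Relation.Binary.PropositionalEquality using (_≡_)
open import Relation.Nullary using (¬_)

-- Lattice points are integer combinations u·e₁ + v·e₂ with e₁ = (1,0),
-- e₂ = (1/2, √3/2).  The "up" cell at (x,y) has vertices (x,y),(x+1,y),(x,y+1);
-- the "down" cell at (x,y) has vertices (x+1,y),(x,y+1),(x+1,y+1).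
-- Up (x,y) is edge-adjacent to Down (x,y), Down (x-1,y), Down (x,y-1).

data Orientation : Set where
  up down : Orientation

record Cell : Set where
  constructor cell
  field
    cx cy : ℤ
    ori   : Orientation

Pt : Set
Pt = ℤ × ℤ

-- three times the centroid (sum of the three vertices), in lattice coordinates
centroid3 : Cell → Pt
centroid3 (cell x y up)   = (+ 3 * x + + 1 , + 3 * y + + 1)
centroid3 (cell x y down) = (+ 3 * x + + 2 , + 3 * y + + 2)

-- rotation by 60° and a reflection, in lattice coordinates
rot : Pt → Pt
rot (u , v) = (- v , u + v)

refl' : Pt → Pt
refl' (u , v) = (v , u)

rotN : ℕ → Pt → Pt
rotN ℕ.zero p = p
rotN (ℕ.suc k) p = rot (rotN k p)

linSym : Fin 6 → Bool → Pt → Pt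
linSym k false p = rotN (Data.Fin.toℕ k) p
linSym k true  p = rotN (Data.Fin.toℕ k) (refl' p)

-- a symmetry of the tiling: linear symmetry followed by a lattice translation t,
-- acting on (3 × centroid) coordinates
isoPt : Fin 6 → Bool → Pt → Pt → Pt
isoPt k r (tx , ty) p with linSym k r p
... | (u , v) = (u + + 3 * tx , v + + 3 * ty)

ContainsCopy : List Cell → List Cell → Set
ContainsCopy A S =
  Σ (Fin 6) λ k → Σ Bool λ r → Σ Pt λ t →
    All (λ c → Any (λ c' → centroid3 c' ≡ isoPt k r t (centroid3 c)) S) A

ValidMove : ℕ → List Cell → List Cell → Set
ValidMove n marked mv = (length mv ≡ n) × Unique mv × All (λ c → c ∉ marked) mv

-- MakerWins a b A M B : with maker's cells M and breaker's cells B, maker to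
-- move, maker can force a win in finitely many turns (inductive, well-founded).
data MakerWins (a b : ℕ) (A : List Cell) : List Cell → List Cell → Set where
  win  : ∀ {M B} (mv : List Cell) → ValidMove a (M ++ B) mv →
         ContainsCopy A (mv ++ M) → MakerWins a b A M B
  step : ∀ {M B} (mv : List Cell) → ValidMove a (M ++ B) mv →
         (∀ (bv : List Cell) → ValidMove b (mv ++ M ++ B) bv →
            MakerWins a b A (mv ++ M) (bv ++ B)) →
         MakerWins a b A M B

Winner : ℕ → ℕ → List Cell → Set
Winner a b A = MakerWins a b A [] []

IsThreshold : List Cell → ℕ → ℕ → Set
IsThreshold A n b = Winner n b A × (∀ b' → b < b' → ¬ Winner n b' A)

InfiniteThreshold : List Cell → ℕ → Set
InfiniteThreshold A n = ∀ b → Winner n b A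

T43 : List Cell
T43 = cell (+ 0) (+ 0) up ∷ cell (+ 0) (+ 0) down ∷ cell -[1+ 0 ] (+ 0) down
      ∷ cell (+ 0) -[1+ 0 ] down ∷ []

module Submission where

-- A copy of T43 is exactly a claw: a cell together with its three
-- edge-neighbours (copy⇒claw, claw⇒copy), so both players fight over claws.
--
-- For a = 1, 2, 3 Breaker pairs every cell with a of its
-- neighbours (symmetrically) and answers each Maker cell by claiming all its
-- partners; with b ≥ a² this is a legal answer and keeps every claw that
-- Maker has touched blocked, since one Maker move cannot contain a cell
-- together with all its partners (PairingStrategy, loser-1/2/3).
--
-- Winners.  (1,0) and (n,b) for n ≥ 4: Maker simply claims a claw.  (3,8):
-- three far-apart cells give nine pairwise disjoint one-move threats, more
-- than Breaker's eight cells can spoil (threatsWin).  (2,3): Maker places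
-- four hubs, each carrying three options with pairwise disjoint zones.  An
-- option is prepared by one more cell; a prepared option whose zone Breaker
-- hit at most once still has a spot whose key cell makes two threats, and two
-- such options give a fork: four disjoint threats against three Breaker
-- cells.  A case analysis on how Breaker spreads his cells over the zones
-- (sixFresh, afterSacrifice, armedAndFour, endgame) always ends in a fork.
--
-- Finite facts about concrete configurations (the images of T43 under the
-- twelve linear symmetries, the table of options, the opening) are verified
-- by evaluating decision procedures.

open import Defs
open import Data.Nat using (ℕ; _≥_)
open import Data.Product using (_×_)

import Data.Nat as ℕ
open import Data.Nat using (_≤_; _<_; z≤n; s≤s)
import Data.Nat.Properties as ℕₚ
open import Data.Integer as ℤ using (+_; -[1+_])
import Data.Integer.Properties as ℤₚ
open import Data.Integer.Tactic.RingSolver using (solve-∀)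
open import Data.Bool using (Bool; true; false)
open import Data.Fin using (Fin)
import Data.Fin as Fin
import Data.Fin.Properties as Finₚ
open import Data.Product using (Σ; ∃; _,_; proj₁; proj₂)
open import Data.Product.Properties using (≡-dec)
open import Data.Sum using (_⊎_; inj₁; inj₂; map₂)
open import Data.Empty using (⊥; ⊥-elim)
open import Data.Unit using (tt)
open import Function using (_∘_)
open import Data.List using (List; []; _∷_; _++_; length; map; concatMap; filter; allFin)
import Data.List.Properties as Listₚ
open import Data.List.Membership.Propositional using (_∈_; _∉_; find; lose)
import Data.List.Membership.Propositional.Properties as ∈ₚ
open import Data.List.Relation.Unary.All as All using (All; []; _∷_)
import Data.List.Relation.Unary.All.Properties as Allₚ
open import Data.List.Relation.Unary.Any as Any using (Any; here; there)
import Data.List.Relation.Unary.Any.Properties as Anyₚ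
open import Data.List.Relation.Unary.AllPairs as AllPairs using (AllPairs; []; _∷_)
import Data.List.Relation.Unary.AllPairs.Properties as AllPairsₚ
open import Data.List.Relation.Unary.Unique.Propositional using (Unique)
import Data.List.Relation.Unary.Unique.Propositional.Properties as Uniqueₚ
open import Data.List.Relation.Binary.Disjoint.Propositional using (Disjoint)
open import Relation.Binary.PropositionalEquality
open import Relation.Nullary using (¬_; Dec; yes; no)
open import Relation.Nullary.Decidable using (toWitness; _×-dec_; ¬?)
import Relation.Nullary.Decidable as Dec
open import Relation.Unary using (Decidable)
open import Relation.Unary.Properties using (∁?)
open import Algebra.Bundles using (AbelianGroup)
open import Algebra.Properties.Group (AbelianGroup.group ℤₚ.+-0-abelianGroup)
  using () renaming (∙-cancelˡ to +-cancelˡ)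
open import Algebra.Properties.CommutativeSemigroup ℕₚ.+-commutativeSemigroup
  using (interchange; x∙yz≈y∙xz)

_≟ᴼ_ : (o o' : Orientation) → Dec (o ≡ o')
up   ≟ᴼ up   = yes refl
up   ≟ᴼ down = no λ ()
down ≟ᴼ up   = no λ ()
down ≟ᴼ down = yes refl

_≟ᶜ_ : (c d : Cell) → Dec (c ≡ d)
cell x y o ≟ᶜ cell x' y' o' with x ℤₚ.≟ x' | y ℤₚ.≟ y' | o ≟ᴼ o'
... | yes refl | yes refl | yes refl = yes refl
... | no x≢x'  | _        | _        = no λ { refl → x≢x' refl }
... | yes _    | no y≢y'  | _        = no λ { refl → y≢y' refl }
... | yes _    | yes _    | no o≢o'  = no λ { refl → o≢o' refl }

open import Data.List.Membership.DecPropositional _≟ᶜ_ using (_∈?_)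

_≟ᴾ_ : (p q : Pt) → Dec (p ≡ q)
_≟ᴾ_ = ≡-dec ℤₚ._≟_ ℤₚ._≟_

infix 4 _⊆_
_⊆_ : List Cell → List Cell → Set
xs ⊆ ys = All (_∈ ys) xs

infix 4 _⊆?_
_⊆?_ : (xs ys : List Cell) → Dec (xs ⊆ ys)
xs ⊆? ys = All.all? (_∈? ys) xs

δ : Fin 3 → Pt
δ Fin.zero             = (+ 0 , + 0)
δ (Fin.suc Fin.zero)   = (-[1+ 0 ] , + 0)
δ (Fin.suc (Fin.suc Fin.zero)) = (+ 0 , -[1+ 0 ])

nbr : Fin 3 → Cell → Cell
nbr i (cell x y up)   = cell (x ℤ.+ proj₁ (δ i)) (y ℤ.+ proj₂ (δ i)) down
nbr i (cell x y down) = cell (x ℤ.- proj₁ (δ i)) (y ℤ.- proj₂ (δ i)) up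

nbrsIn : List (Fin 3) → Cell → List Cell
nbrsIn I X = map (λ i → nbr i X) I

nbrs : Cell → List Cell
nbrs = nbrsIn (allFin 3)

claw : Cell → List Cell
claw X = X ∷ nbrs X

nbr-involutive : ∀ i X → nbr i (nbr i X) ≡ X
nbr-involutive i (cell x y up)   = cong₂ (λ a b → cell a b up) (cancel x _) (cancel y _)
  where cancel : ∀ x d → (x ℤ.+ d) ℤ.- d ≡ x
        cancel = solve-∀
nbr-involutive i (cell x y down) = cong₂ (λ a b → cell a b down) (cancel x _) (cancel y _)
  where cancel : ∀ x d → (x ℤ.- d) ℤ.+ d ≡ x
        cancel = solve-∀

nbr-injective : ∀ X {i j} → nbr i X ≡ nbr j X → i ≡ j
nbr-injective X {i} {j} eq = δ-injective (offsets X (cong Cell.cx eq) (cong Cell.cy eq))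
  where
  δ-injective : ∀ {i j} → δ i ≡ δ j → i ≡ j
  δ-injective {Fin.zero}                     {Fin.zero}                     _ = refl
  δ-injective {Fin.suc Fin.zero}             {Fin.suc Fin.zero}             _ = refl
  δ-injective {Fin.suc (Fin.suc Fin.zero)}   {Fin.suc (Fin.suc Fin.zero)}   _ = refl
  δ-injective {Fin.zero}                     {Fin.suc Fin.zero}             ()
  δ-injective {Fin.zero}                     {Fin.suc (Fin.suc Fin.zero)}   ()
  δ-injective {Fin.suc Fin.zero}             {Fin.zero}                     ()
  δ-injective {Fin.suc Fin.zero}             {Fin.suc (Fin.suc Fin.zero)}   ()
  δ-injective {Fin.suc (Fin.suc Fin.zero)}   {Fin.zero}                     ()
  δ-injective {Fin.suc (Fin.suc Fin.zero)}   {Fin.suc Fin.zero}             ()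
  offsets : ∀ X → Cell.cx (nbr i X) ≡ Cell.cx (nbr j X) → Cell.cy (nbr i X) ≡ Cell.cy (nbr j X) → δ i ≡ δ j
  offsets (cell x y up)   ex ey = cong₂ _,_ (+-cancelˡ x _ _ ex) (+-cancelˡ y _ _ ey)
  offsets (cell x y down) ex ey =
    cong₂ _,_ (ℤₚ.neg-injective (+-cancelˡ x _ _ ex)) (ℤₚ.neg-injective (+-cancelˡ y _ _ ey))

nbr-flips : ∀ i X → Cell.ori (nbr i X) ≢ Cell.ori X
nbr-flips i (cell x y up)   ()
nbr-flips i (cell x y down) ()

translate : Pt → Cell → Cell
translate (tx , ty) (cell x y o) = cell (tx ℤ.+ x) (ty ℤ.+ y) o

shiftPt : Pt → Pt → Pt
shiftPt (tx , ty) (u , v) = (u ℤ.+ + 3 ℤ.* tx , v ℤ.+ + 3 ℤ.* ty)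

centroid-translate : ∀ t c → centroid3 (translate t c) ≡ shiftPt t (centroid3 c)
centroid-translate (tx , ty) (cell x y up)   = cong₂ _,_ (lemma tx x) (lemma ty y)
  where lemma : ∀ t x → + 3 ℤ.* (t ℤ.+ x) ℤ.+ + 1 ≡ (+ 3 ℤ.* x ℤ.+ + 1) ℤ.+ + 3 ℤ.* t
        lemma = solve-∀
centroid-translate (tx , ty) (cell x y down) = cong₂ _,_ (lemma tx x) (lemma ty y)
  where lemma : ∀ t x → + 3 ℤ.* (t ℤ.+ x) ℤ.+ + 2 ≡ (+ 3 ℤ.* x ℤ.+ + 2) ℤ.+ + 3 ℤ.* t
        lemma = solve-∀

translate-nbr : ∀ t i X → translate t (nbr i X) ≡ nbr i (translate t X)
translate-nbr (tx , ty) i (cell x y up)   =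
  cong₂ (λ a b → cell a b down) (sym (ℤₚ.+-assoc tx x _)) (sym (ℤₚ.+-assoc ty y _))
translate-nbr (tx , ty) i (cell x y down) =
  cong₂ (λ a b → cell a b up) (sym (ℤₚ.+-assoc tx x _)) (sym (ℤₚ.+-assoc ty y _))

claw-translate : ∀ t X → claw (translate t X) ≡ map (translate t) (claw X)
claw-translate t X = cong (translate t X ∷_) (begin
  map (λ i → nbr i (translate t X)) (allFin 3)  ≡⟨ Listₚ.map-cong (λ i → sym (translate-nbr t i X)) (allFin 3) ⟩
  map (λ i → translate t (nbr i X)) (allFin 3)  ≡⟨ Listₚ.map-∘ {g = translate t} {f = λ i → nbr i X} (allFin 3) ⟩
  map (translate t) (nbrs X)                    ∎)
  where open ≡-Reasoning

-- Centroids determine cells: 3·centroid is ≡ 1 (mod 3) for up cells and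
-- ≡ 2 (mod 3) for down cells.
private
  3x+e-injective : ∀ e x x' → + 3 ℤ.* x ℤ.+ e ≡ + 3 ℤ.* x' ℤ.+ e → x ≡ x'
  3x+e-injective e x x' eq =
    ℤₚ.*-cancelˡ-≡ (+ 3) x x' (trans (sym (undo e x)) (trans (cong (ℤ._- e) eq) (undo e x')))
    where
    undo : ∀ e x → (+ 3 ℤ.* x ℤ.+ e) ℤ.- e ≡ + 3 ℤ.* x
    undo = solve-∀

  3x+1≢3x'+2 : ∀ x x' → + 3 ℤ.* x ℤ.+ + 1 ≢ + 3 ℤ.* x' ℤ.+ + 2
  3x+1≢3x'+2 x x' eq = no-third ℤ.∣ x ℤ.- x' ∣ (begin
      3 ℕ.* ℤ.∣ x ℤ.- x' ∣         ≡⟨ ℤₚ.abs-* (+ 3) (x ℤ.- x') ⟨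
      ℤ.∣ + 3 ℤ.* (x ℤ.- x') ∣
        ≡⟨ cong ℤ.∣_∣ (trans (difference x x') (cong (ℤ._- (+ 3 ℤ.* x' ℤ.+ + 1)) eq)) ⟩
      ℤ.∣ (+ 3 ℤ.* x' ℤ.+ + 2) ℤ.- (+ 3 ℤ.* x' ℤ.+ + 1) ∣ ≡⟨ cong ℤ.∣_∣ (one x') ⟩
      1                              ∎)
    where
    open ≡-Reasoning
    difference : ∀ x x' → + 3 ℤ.* (x ℤ.- x') ≡ (+ 3 ℤ.* x ℤ.+ + 1) ℤ.- (+ 3 ℤ.* x' ℤ.+ + 1)
    difference = solve-∀
    one : ∀ x' → (+ 3 ℤ.* x' ℤ.+ + 2) ℤ.- (+ 3 ℤ.* x' ℤ.+ + 1) ≡ + 1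
    one = solve-∀
    no-third : ∀ m → 3 ℕ.* m ≢ 1
    no-third 0 ()
    no-third 1 ()
    no-third (ℕ.suc (ℕ.suc m)) ()

centroid-injective : ∀ c d → centroid3 c ≡ centroid3 d → c ≡ d
centroid-injective (cell x y up) (cell x' y' up) eq
  with 3x+e-injective (+ 1) x x' (cong proj₁ eq) | 3x+e-injective (+ 1) y y' (cong proj₂ eq)
... | refl | refl = refl
centroid-injective (cell x y down) (cell x' y' down) eq
  with 3x+e-injective (+ 2) x x' (cong proj₁ eq) | 3x+e-injective (+ 2) y y' (cong proj₂ eq)
... | refl | refl = refl
centroid-injective (cell x y up) (cell x' y' down) eq = ⊥-elim (3x+1≢3x'+2 x x' (cong proj₁ eq))
centroid-injective (cell x y down) (cell x' y' up) eq = ⊥-elim (3x+1≢3x'+2 x' x (sym (cong proj₁ eq)))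

-- The centre of the image of T43 under the linear symmetry rot^k (∘ refl):
-- the image of the centroid (1,1) of the origin cell.
imageCentre : Fin 6 → Cell
imageCentre Fin.zero                                                  = cell (+ 0) (+ 0) up
imageCentre (Fin.suc Fin.zero)                                        = cell -[1+ 0 ] (+ 0) down
imageCentre (Fin.suc (Fin.suc Fin.zero))                              = cell -[1+ 0 ] (+ 0) up
imageCentre (Fin.suc (Fin.suc (Fin.suc Fin.zero)))                    = cell -[1+ 0 ] -[1+ 0 ] down
imageCentre (Fin.suc (Fin.suc (Fin.suc (Fin.suc Fin.zero))))          = cell (+ 0) -[1+ 0 ] up
imageCentre (Fin.suc (Fin.suc (Fin.suc (Fin.suc (Fin.suc Fin.zero))))) = cell (+ 0) -[1+ 0 ] down

ImageOfT43 : Fin 6 → Bool → Cell → Set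
ImageOfT43 k r y = Any (λ c → linSym k r (centroid3 c) ≡ centroid3 y) T43

LandsInClaw : Fin 6 → Bool → Cell → Set
LandsInClaw k r c = Any (λ y → linSym k r (centroid3 c) ≡ centroid3 y) (claw (imageCentre k))

-- Both inclusions are checked by evaluation; the results are
-- opaque so that later type checking never re-runs the evaluation.
private
  forEverySymmetry : {P : Fin 6 → Bool → Set} → (∀ k r → Dec (P k r)) → Dec (∀ k r → P k r)
  forEverySymmetry P? with Finₚ.all? (λ k → P? k false ×-dec P? k true)
  ... | yes both = yes λ { k false → proj₁ (both k) ; k true → proj₂ (both k) }
  ... | no ¬both = no λ all → ¬both λ k → all k false , all k true

opaque
  image⊇claw : ∀ k r → All (ImageOfT43 k r) (claw (imageCentre k))
  image⊇claw = toWitness {a? = forEverySymmetry λ k r →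
    All.all? (λ y → Any.any? (λ c → linSym k r (centroid3 c) ≟ᴾ centroid3 y) T43) (claw (imageCentre k))} tt

  image⊆claw : ∀ k r → All (LandsInClaw k r) T43
  image⊆claw = toWitness {a? = forEverySymmetry λ k r →
    All.all? (λ c → Any.any? (λ y → linSym k r (centroid3 c) ≟ᴾ centroid3 y) (claw (imageCentre k))) T43} tt

HasCentroid : List Cell → Pt → Set
HasCentroid S p = Any (λ c' → centroid3 c' ≡ p) S

∈⇒HasCentroid : ∀ {S c} → c ∈ S → HasCentroid S (centroid3 c)
∈⇒HasCentroid = Any.map (λ c≡c' → cong centroid3 (sym c≡c'))

HasCentroid⇒∈ : ∀ {S c} → HasCentroid S (centroid3 c) → c ∈ S
HasCentroid⇒∈ {c = c} = Any.map λ {c'} eq → centroid-injective c c' (sym eq)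

copy⇒claw : ∀ S → ContainsCopy T43 S → ∃ λ X → claw X ⊆ S
copy⇒claw S (k , r , t , hits) = translate t (imageCentre k) ,
  subst (_⊆ S) (sym (claw-translate t (imageCentre k)))
        (All.tabulate λ y∈ → let y' , y'∈ , y≡ = ∈ₚ.∈-map⁻ (translate t) y∈ in
                             subst (_∈ S) (sym y≡) (moved y'∈))
  where
  moved : ∀ {y'} → y' ∈ claw (imageCentre k) → translate t y' ∈ S
  moved {y'} y'∈ with find (All.lookup (image⊇claw k r) y'∈)
  ... | c , c∈ , img = HasCentroid⇒∈ (subst (HasCentroid S)
          (trans (cong (shiftPt t) img) (sym (centroid-translate t y'))) (All.lookup hits c∈))

asTranslate : ∀ X → Σ (Fin 6) λ k → Σ Pt λ t → translate t (imageCentre k) ≡ X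
asTranslate (cell x y up)   =
  Fin.zero , (x , y) , cong₂ (λ a b → cell a b up) (ℤₚ.+-identityʳ x) (ℤₚ.+-identityʳ y)
asTranslate (cell x y down) =
  Fin.suc Fin.zero , (x ℤ.+ + 1 , y) , cong₂ (λ a b → cell a b down) (undo x) (ℤₚ.+-identityʳ y)
  where
  undo : ∀ x → (x ℤ.+ + 1) ℤ.+ -[1+ 0 ] ≡ x
  undo = solve-∀

claw⇒copy : ∀ S X → claw X ⊆ S → ContainsCopy T43 S
claw⇒copy S X sub with asTranslate X
... | k , t , refl = k , false , t , All.tabulate hit
  where
  hit : ∀ {c} → c ∈ T43 → HasCentroid S (isoPt k false t (centroid3 c))
  hit c∈ with find (All.lookup (image⊆claw k false) c∈)
  ... | y , y∈ , img =
    subst (HasCentroid S) (trans (centroid-translate t y) (cong (shiftPt t) (sym img)))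
      (∈⇒HasCentroid (All.lookup sub
        (subst (translate t y ∈_) (sym (claw-translate t (imageCentre k))) (∈ₚ.∈-map⁺ (translate t) y∈))))

-- Fresh cells: beyond the largest |x|-coordinate occurring in L.
private
  width : List Cell → ℕ
  width []      = 0
  width (c ∷ L) = ℤ.∣ Cell.cx c ∣ ℕ.+ width L

  ≤width : ∀ {c L} → c ∈ L → ℤ.∣ Cell.cx c ∣ ≤ width L
  ≤width (here refl) = ℕₚ.m≤m+n _ _
  ≤width (there c∈)  = ℕₚ.≤-trans (≤width c∈) (ℕₚ.m≤n+m _ _)

  row : ℕ → ℕ → List Cell
  row k 0           = []
  row k (ℕ.suc n) = cell (+ k) (+ 0) up ∷ row (ℕ.suc k) n

  row-far : ∀ {k n c} → c ∈ row k n → ∃ λ j → k ≤ j × c ≡ cell (+ j) (+ 0) up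
  row-far {k} {ℕ.suc n} (here refl) = k , ℕₚ.≤-refl , refl
  row-far {k} {ℕ.suc n} (there c∈) =
    let j , k<j , eq = row-far c∈ in j , ℕₚ.≤-trans (ℕₚ.n≤1+n k) k<j , eq

  row-length : ∀ k n → length (row k n) ≡ n
  row-length k 0         = refl
  row-length k (ℕ.suc n) = cong ℕ.suc (row-length (ℕ.suc k) n)

  row-unique : ∀ k n → Unique (row k n)
  row-unique k 0         = []
  row-unique k (ℕ.suc n) = All.tabulate (λ c∈ → first≢ (row-far c∈)) ∷ row-unique (ℕ.suc k) n
    where
    first≢ : ∀ {c} → (∃ λ j → ℕ.suc k ≤ j × c ≡ cell (+ j) (+ 0) up) → cell (+ k) (+ 0) up ≢ c
    first≢ (j , k<j , refl) refl = ℕₚ.1+n≰n k<j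

freshMove : ∀ marked n → Σ (List Cell) (ValidMove n marked)
freshMove marked n = row (ℕ.suc (width marked)) n ,
  row-length _ n , row-unique _ n , All.tabulate (λ c∈ → unmarked (row-far c∈))
  where
  unmarked : ∀ {c} → (∃ λ j → ℕ.suc (width marked) ≤ j × c ≡ cell (+ j) (+ 0) up) → c ∉ marked
  unmarked (j , far , refl) c∈ = ℕₚ.<⇒≱ far (≤width c∈)

private
  unmarkedPart : (marked W : List Cell) →
    Σ (List Cell) λ L → Unique L × All (_∉ marked) L × length L ≤ length W
      × (∀ {w} → w ∈ W → w ∈ marked ⊎ w ∈ L)
  unmarkedPart marked [] = [] , [] , [] , z≤n , λ ()
  unmarkedPart marked (w ∷ W) with unmarkedPart marked W
  ... | L , uL , freeL , lenL , covL with w ∈? marked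
  ...   | yes w∈ =
    L , uL , freeL , ℕₚ.m≤n⇒m≤1+n lenL , λ { (here refl) → inj₁ w∈ ; (there h) → covL h }
  ...   | no w∉ with w ∈? L
  ...     | yes w∈L =
    L , uL , freeL , ℕₚ.m≤n⇒m≤1+n lenL , λ { (here refl) → inj₂ w∈L ; (there h) → covL h }
  ...     | no w∉L =
    w ∷ L , All.tabulate (λ c∈ w≡c → w∉L (subst (_∈ L) (sym w≡c) c∈)) ∷ uL , w∉ ∷ freeL , s≤s lenL ,
    λ { (here refl) → inj₂ (here refl) ; (there h) → map₂ there (covL h) }

coveringMove : ∀ b marked W → length W ≤ b →
  Σ (List Cell) λ bv → ValidMove b marked bv × (∀ {w} → w ∈ W → w ∈ marked ⊎ w ∈ bv)
coveringMove b marked W |W|≤b with unmarkedPart marked W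
... | L , uL , freeL , lenL , covL with freshMove (marked ++ L) (b ℕ.∸ length L)
...   | Fr , lenFr , uFr , freeFr =
  L ++ Fr ,
  (trans (Listₚ.length-++ L) (trans (cong (length L ℕ.+_) lenFr)
                                     (ℕₚ.m+[n∸m]≡n (ℕₚ.≤-trans lenL |W|≤b))) ,
   Uniqueₚ.++⁺ uL uFr (λ { (c∈L , c∈Fr) → All.lookup freeFr c∈Fr (∈ₚ.∈-++⁺ʳ marked c∈L) }) ,
   Allₚ.++⁺ freeL (All.map (λ c∉ c∈ → c∉ (∈ₚ.∈-++⁺ˡ c∈)) freeFr)) ,
  λ w∈ → map₂ ∈ₚ.∈-++⁺ˡ (covL w∈)

hits : List Cell → List Cell → ℕ
hits S [] = 0
hits S (y ∷ ys) with y ∈? S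
... | yes _ = ℕ.suc (hits S ys)
... | no _  = hits S ys

hits-++ : ∀ S xs ys → hits S (xs ++ ys) ≡ hits S xs ℕ.+ hits S ys
hits-++ S []       ys = refl
hits-++ S (x ∷ xs) ys with x ∈? S
... | yes _ = cong ℕ.suc (hits-++ S xs ys)
... | no _  = hits-++ S xs ys

hit⇒hits≥1 : ∀ {c S ys} → c ∈ S → c ∈ ys → 1 ≤ hits S ys
hit⇒hits≥1 {S = S} {y ∷ ys} c∈S c∈ys with y ∈? S | c∈ys
... | yes _   | _          = s≤s z≤n
... | no y∉S  | here refl  = ⊥-elim (y∉S c∈S)
... | no _    | there c∈ys = hit⇒hits≥1 c∈S c∈ys

hits≡0⇒∉ : ∀ {c S ys} → hits S ys ≡ 0 → c ∈ S → c ∉ ys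
hits≡0⇒∉ none c∈S c∈ys = ℕₚ.1+n≰n (subst (1 ≤_) none (hit⇒hits≥1 c∈S c∈ys))

free⇒hits≡0 : ∀ {S B} → All (_∉ B) S → hits S B ≡ 0
free⇒hits≡0 {S} {[]}    _    = refl
free⇒hits≡0 {S} {b ∷ B} free with b ∈? S
... | yes b∈S = ⊥-elim (All.lookup free b∈S (here refl))
... | no _    = free⇒hits≡0 (All.map (λ c∉ c∈ → c∉ (there c∈)) free)

hits-after : ∀ S bv {B} → hits S B ≡ 0 → hits S (bv ++ B) ≡ hits S bv
hits-after S bv {B} none = trans (hits-++ S bv B) (trans (cong (hits S bv ℕ.+_) none) (ℕₚ.+-identityʳ _))

hits≤1⇒same : ∀ {S c e} ys → hits S ys ≤ 1 → c ∈ S → c ∈ ys → e ∈ S → e ∈ ys → c ≡ e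
hits≤1⇒same {S} {c} {e} ys ≤1 c∈S c∈ys e∈S e∈ys with c ≟ᶜ e
... | yes c≡e = c≡e
... | no c≢e  = ⊥-elim (ℕₚ.<⇒≱ (two ys c∈S c∈ys e∈S e∈ys c≢e) ≤1)
  where
  two : ∀ {c e} ys → c ∈ S → c ∈ ys → e ∈ S → e ∈ ys → c ≢ e → 2 ≤ hits S ys
  two (y ∷ ys) c∈S c∈ys e∈S e∈ys c≢e with y ∈? S | c∈ys | e∈ys
  ... | yes _ | here refl  | here refl  = ⊥-elim (c≢e refl)
  ... | yes _ | here refl  | there e∈ys = s≤s (hit⇒hits≥1 e∈S e∈ys)
  ... | yes _ | there c∈ys | here refl  = s≤s (hit⇒hits≥1 c∈S c∈ys)
  ... | yes _ | there c∈ys | there e∈ys = ℕₚ.m≤n⇒m≤1+n (two ys c∈S c∈ys e∈S e∈ys c≢e)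
  ... | no y∉S | here refl | _          = ⊥-elim (y∉S c∈S)
  ... | no y∉S | there _   | here refl  = ⊥-elim (y∉S e∈S)
  ... | no _  | there c∈ys | there e∈ys = two ys c∈S c∈ys e∈S e∈ys c≢e

sumOver : (List Cell → ℕ) → List (List Cell) → ℕ
sumOver f []       = 0
sumOver f (S ∷ Ss) = f S ℕ.+ sumOver f Ss

sumOver-≥length : ∀ f Ss → All (λ S → 1 ≤ f S) Ss → length Ss ≤ sumOver f Ss
sumOver-≥length f []       []         = z≤n
sumOver-≥length f (S ∷ Ss) (≥1 ∷ ≥1s) = ℕₚ.+-mono-≤ ≥1 (sumOver-≥length f Ss ≥1s)

-- A cell lies in at most one member of a pairwise disjoint family, so the
-- hits of ys in the members of the family add up to at most |ys|.
hits-disjoint-family : ∀ Ss → AllPairs Disjoint Ss → ∀ ys → sumOver (λ S → hits S ys) Ss ≤ length ys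
hits-disjoint-family Ss disj []       = ℕₚ.≤-reflexive (none Ss)
  where
  none : ∀ Ss → sumOver (λ S → hits S []) Ss ≡ 0
  none []       = refl
  none (_ ∷ Ss) = none Ss
hits-disjoint-family Ss disj (y ∷ ys) = begin
  sumOver (λ S → hits S (y ∷ ys)) Ss                              ≡⟨ split Ss ⟩
  sumOver (λ S → hits S (y ∷ [])) Ss ℕ.+ sumOver (λ S → hits S ys) Ss
    ≤⟨ ℕₚ.+-mono-≤ (once Ss disj) (hits-disjoint-family Ss disj ys) ⟩
  1 ℕ.+ length ys                                                 ∎
  where
  open ℕₚ.≤-Reasoning
  split : ∀ Ss → sumOver (λ S → hits S (y ∷ ys)) Ss
               ≡ sumOver (λ S → hits S (y ∷ [])) Ss ℕ.+ sumOver (λ S → hits S ys) Ss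
  split []       = refl
  split (S ∷ Ss) = trans (cong₂ ℕ._+_ (hits-++ S (y ∷ []) ys) (split Ss))
                         (interchange (hits S (y ∷ [])) _ _ _)
  absent : ∀ Ss → All (y ∉_) Ss → sumOver (λ S → hits S (y ∷ [])) Ss ≡ 0
  absent []       []           = refl
  absent (S ∷ Ss) (y∉S ∷ y∉Ss) with y ∈? S
  ... | yes y∈S = ⊥-elim (y∉S y∈S)
  ... | no _    = absent Ss y∉Ss
  once : ∀ Ss → AllPairs Disjoint Ss → sumOver (λ S → hits S (y ∷ [])) Ss ≤ 1
  once []       []                = z≤n
  once (S ∷ Ss) (disjS ∷ disjSs) with y ∈? S
  ... | yes y∈S = ℕₚ.≤-reflexive (cong ℕ.suc (absent Ss (All.map (λ d y∈T → d (y∈S , y∈T)) disjS)))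
  ... | no _    = once Ss disjSs

length-concatMap : ∀ {A C : Set} (R : A → List C) a → (∀ X → length (R X) ≡ a) →
                   ∀ xs → length (concatMap R xs) ≡ length xs ℕ.* a
length-concatMap R a |R| []       = refl
length-concatMap R a |R| (x ∷ xs) =
  trans (Listₚ.length-++ (R x)) (cong₂ ℕ._+_ (|R| x) (length-concatMap R a |R| xs))

length-split : ∀ {A : Set} {P : A → Set} (P? : Decidable P) xs →
               length (filter P? xs) ℕ.+ length (filter (∁? P?) xs) ≡ length xs
length-split P? []       = refl
length-split P? (x ∷ xs) with P? x
... | yes _ = cong ℕ.suc (length-split P? xs)
... | no _  = trans (ℕₚ.+-suc _ _) (cong ℕ.suc (length-split P? xs))

pigeonhole : ∀ Ss → AllPairs Disjoint Ss → ∀ ys → length ys < length Ss → Any (λ S → hits S ys ≡ 0) Ss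
pigeonhole Ss disj ys short with Any.any? (λ S → hits S ys ℕ.≟ 0) Ss
... | yes untouched = untouched
... | no ¬untouched = ⊥-elim (ℕₚ.<⇒≱ short (ℕₚ.≤-trans
        (sumOver-≥length (λ S → hits S ys) Ss (All.tabulate positive)) (hits-disjoint-family Ss disj ys)))
  where
  positive : ∀ {S} → S ∈ Ss → 1 ≤ hits S ys
  positive {S} S∈ with hits S ys in eq
  ... | 0       = ⊥-elim (¬untouched (lose S∈ eq))
  ... | ℕ.suc _ = s≤s z≤n

unique-⊆⇒length≤ : ∀ xs ys → Unique xs → xs ⊆ ys → length xs ≤ length ys
unique-⊆⇒length≤ xs ys uniq sub = begin
  length xs                              ≡⟨ Listₚ.length-map ⟦_⟧ xs ⟨
  length (map ⟦_⟧ xs)                    ≤⟨ sumOver-≥length (λ S → hits S ys) (map ⟦_⟧ xs) (each xs sub) ⟩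
  sumOver (λ S → hits S ys) (map ⟦_⟧ xs) ≤⟨ hits-disjoint-family (map ⟦_⟧ xs) (singletons xs uniq) ys ⟩
  length ys                              ∎
  where
  open ℕₚ.≤-Reasoning
  ⟦_⟧ : Cell → List Cell
  ⟦ c ⟧ = c ∷ []
  each : ∀ xs → xs ⊆ ys → All (λ S → 1 ≤ hits S ys) (map ⟦_⟧ xs)
  each []       []           = []
  each (x ∷ xs) (x∈ ∷ xs⊆)   = hit⇒hits≥1 (here refl) x∈ ∷ each xs xs⊆
  singletons : ∀ xs → Unique xs → AllPairs Disjoint (map ⟦_⟧ xs)
  singletons []       []             = []
  singletons (x ∷ xs) (x∉xs ∷ uniq) = apart xs x∉xs ∷ singletons xs uniq
    where
    apart : ∀ xs → All (x ≢_) xs → All (Disjoint ⟦ x ⟧) (map ⟦_⟧ xs)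
    apart []       []           = []
    apart (z ∷ zs) (x≢z ∷ x≢zs) = (λ { (here refl , here refl) → x≢z refl }) ∷ apart zs x≢zs

Blocked : List Cell → Cell → Set
Blocked B X = Any (_∈ B) (claw X)

-- Whenever Maker
-- claims a cell m, Breaker claims all of R m; with b ≥ a² this is one legal
-- Breaker move per Maker move.  Every claw touched by Maker is then blocked
-- right after Breaker's move, because Maker cannot take a cell X together
-- with all of R X in a single move of a cells.
module PairingStrategy (a : ℕ) (R : Cell → List Cell)
  (|R| : ∀ X → length (R X) ≡ a)
  (R⊆claw : ∀ X {y} → y ∈ R X → y ∈ claw X)
  (R-sym : ∀ X {y} → y ∈ R X → X ∈ R y)
  (R-fresh : ∀ X → Unique (X ∷ R X))
  (b : ℕ) (a²≤b : a ℕ.* a ≤ b) where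

  Watched : List Cell → Cell → Set
  Watched M X = X ∈ M ⊎ Any (_∈ M) (R X)

  record Invariant (M B : List Cell) : Set where
    field
      watched⇒blocked : ∀ X → Watched M X → Blocked B X
      disjoint        : ∀ {c} → c ∈ M → c ∉ B
  open Invariant

  overfull : ∀ {marked mv X} → ValidMove a marked mv → X ∈ mv → R X ⊆ mv → ⊥
  overfull {mv = mv} {X} (len , uniq , _) X∈ RX⊆ =
    ℕₚ.1+n≰n (subst₂ _≤_ (cong ℕ.suc (|R| X)) len
      (unique-⊆⇒length≤ (X ∷ R X) mv (R-fresh X) (X∈ ∷ RX⊆)))

  -- If the claw at X is unblocked and X lies in Maker's move, then Maker's
  -- partners of X all lie in the move too (one in M would have blocked the
  -- claw already), so the move would contain X and all of R X.
  unblocked-centre : ∀ {M B mv X} → Invariant M B → ¬ Blocked B X → ValidMove a (M ++ B) mv →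
                     X ∈ mv → (∀ {y} → y ∈ R X → y ∈ mv ++ M) → ⊥
  unblocked-centre {M} {B} {mv} {X} inv free valid X∈ R⊆ = overfull valid X∈ (All.tabulate inMove)
    where
    inMove : ∀ {y} → y ∈ R X → y ∈ mv
    inMove y∈R with ∈ₚ.∈-++⁻ mv (R⊆ y∈R)
    ... | inj₁ y∈mv = y∈mv
    ... | inj₂ y∈M  = ⊥-elim (free (watched⇒blocked inv X (inj₂ (lose y∈R y∈M))))

  noClaw : ∀ {M B mv X} → Invariant M B → ValidMove a (M ++ B) mv → claw X ⊆ mv ++ M → ⊥
  noClaw {M} {B} {mv} {X} inv valid@(_ , _ , fresh) claw⊆ = centre (∈ₚ.∈-++⁻ mv (All.head claw⊆))
    where
    free : ¬ Blocked B X
    free blk with find blk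
    ... | c , c∈claw , c∈B with ∈ₚ.∈-++⁻ mv (All.lookup claw⊆ c∈claw)
    ... | inj₁ c∈mv = All.lookup fresh c∈mv (∈ₚ.∈-++⁺ʳ M c∈B)
    ... | inj₂ c∈M  = disjoint inv c∈M c∈B
    centre : X ∈ mv ⊎ X ∈ M → ⊥
    centre (inj₁ X∈mv) = unblocked-centre inv free valid X∈mv (λ y∈R → All.lookup claw⊆ (R⊆claw X y∈R))
    centre (inj₂ X∈M)  = free (watched⇒blocked inv X (inj₁ X∈M))

  answer : ∀ M B mv → ValidMove a (M ++ B) mv →
           Σ (List Cell) λ bv → ValidMove b (mv ++ M ++ B) bv
             × (∀ {w} → w ∈ concatMap R mv → w ∈ mv ++ M ++ B ⊎ w ∈ bv)
  answer M B mv (len , _) = coveringMove b (mv ++ M ++ B) (concatMap R mv)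
    (subst (_≤ b) (sym (trans (length-concatMap R a |R| mv) (cong (ℕ._* a) len))) a²≤b)

  preserved : ∀ {M B mv bv} → Invariant M B → ValidMove a (M ++ B) mv → ValidMove b (mv ++ M ++ B) bv →
              (∀ {w} → w ∈ concatMap R mv → w ∈ mv ++ M ++ B ⊎ w ∈ bv) → Invariant (mv ++ M) (bv ++ B)
  preserved {M} {B} {mv} {bv} inv valid@(_ , _ , fresh) (_ , _ , freshᵇ) covered = record
    { watched⇒blocked = blocked ; disjoint = disjoint′ }
    where
    disjoint′ : ∀ {c} → c ∈ mv ++ M → c ∉ bv ++ B
    disjoint′ {c} c∈ c∈′ with ∈ₚ.∈-++⁻ mv c∈ | ∈ₚ.∈-++⁻ bv c∈′
    ... | inj₁ c∈mv | inj₁ c∈bv = All.lookup freshᵇ c∈bv (∈ₚ.∈-++⁺ˡ c∈mv)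
    ... | inj₁ c∈mv | inj₂ c∈B  = All.lookup fresh c∈mv (∈ₚ.∈-++⁺ʳ M c∈B)
    ... | inj₂ c∈M  | inj₁ c∈bv = All.lookup freshᵇ c∈bv (∈ₚ.∈-++⁺ʳ mv (∈ₚ.∈-++⁺ˡ c∈M))
    ... | inj₂ c∈M  | inj₂ c∈B  = disjoint inv c∈M c∈B
    module Unblocked (X : Cell) (free′ : ¬ Blocked (bv ++ B) X) where
      free : ¬ Blocked B X
      free blk = free′ (Any.map (∈ₚ.∈-++⁺ʳ bv) blk)
      toMaker : ∀ {c} → c ∈ claw X → c ∈ mv ++ M ++ B ⊎ c ∈ bv → c ∈ mv ++ M
      toMaker c∈claw (inj₂ c∈bv) = ⊥-elim (free′ (lose c∈claw (∈ₚ.∈-++⁺ˡ c∈bv)))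
      toMaker {c} c∈claw (inj₁ c∈) with ∈ₚ.∈-++⁻ (mv ++ M) (subst (c ∈_) (sym (Listₚ.++-assoc mv M B)) c∈)
      ... | inj₁ c∈mvM = c∈mvM
      ... | inj₂ c∈B   = ⊥-elim (free′ (lose c∈claw (∈ₚ.∈-++⁺ʳ bv c∈B)))
      centre : X ∈ mv ++ M → ⊥
      centre X∈ with ∈ₚ.∈-++⁻ mv X∈
      ... | inj₁ X∈mv = unblocked-centre inv free valid X∈mv
                          (λ y∈R → toMaker (R⊆claw X y∈R) (covered (Anyₚ.concatMap⁺ R (lose X∈mv y∈R))))
      ... | inj₂ X∈M  = free (watched⇒blocked inv X (inj₁ X∈M))
      partner : Any (_∈ mv ++ M) (R X) → ⊥
      partner some with find some
      ... | y , y∈R , y∈ with ∈ₚ.∈-++⁻ mv y∈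
      ... | inj₁ y∈mv = centre (toMaker (here refl) (covered (Anyₚ.concatMap⁺ R (lose y∈mv (R-sym X y∈R)))))
      ... | inj₂ y∈M  = free (watched⇒blocked inv X (inj₂ (lose y∈R y∈M)))
    blocked : ∀ X → Watched (mv ++ M) X → Blocked (bv ++ B) X
    blocked X watched with Any.any? (_∈? bv ++ B) (claw X)
    ... | yes blk = blk
    ... | no free′ with watched
    ...   | inj₁ X∈     = ⊥-elim (Unblocked.centre X free′ X∈)
    ...   | inj₂ partnr = ⊥-elim (Unblocked.partner X free′ partnr)

  loses : ∀ {M B} → Invariant M B → MakerWins a b T43 M B → ⊥
  loses inv (win mv valid copy) = noClaw inv valid (proj₂ (copy⇒claw _ copy))
  loses {M} {B} inv (step mv valid next) with answer M B mv valid
  ... | bv , validᵇ , covered = loses (preserved inv valid validᵇ covered) (next bv validᵇ)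

  loser : ¬ Winner a b T43
  loser = loses record { watched⇒blocked = λ { X (inj₁ ()) ; X (inj₂ some) → ⊥-elim (nothing some) }
                       ; disjoint = λ () }
    where
    nothing : ∀ {xs : List Cell} → Any (_∈ []) xs → ⊥
    nothing (here ())
    nothing (there some) = nothing some

pairingLoser : ∀ (I : List (Fin 3)) → Unique I → ∀ b → length I ℕ.* length I ≤ b → ¬ Winner (length I) b T43
pairingLoser I uniqI = PairingStrategy.loser (length I) (nbrsIn I)
  (λ X → Listₚ.length-map (λ i → nbr i X) I) R⊆claw R-sym R-fresh
  where
  R⊆claw : ∀ X {y} → y ∈ nbrsIn I X → y ∈ claw X
  R⊆claw X y∈ with ∈ₚ.∈-map⁻ (λ i → nbr i X) y∈
  ... | i , _ , refl = there (∈ₚ.∈-map⁺ (λ i → nbr i X) (∈ₚ.∈-allFin i))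
  R-sym : ∀ X {y} → y ∈ nbrsIn I X → X ∈ nbrsIn I y
  R-sym X y∈ with ∈ₚ.∈-map⁻ (λ i → nbr i X) y∈
  ... | i , i∈I , refl =
    subst (_∈ nbrsIn I (nbr i X)) (nbr-involutive i X) (∈ₚ.∈-map⁺ (λ j → nbr j (nbr i X)) i∈I)
  R-fresh : ∀ X → Unique (X ∷ nbrsIn I X)
  R-fresh X = All.tabulate (λ y∈ X≡y → differs y∈ X≡y) ∷ Uniqueₚ.map⁺ (nbr-injective X) uniqI
    where
    differs : ∀ {y} → y ∈ nbrsIn I X → X ≢ y
    differs y∈ X≡y with ∈ₚ.∈-map⁻ (λ i → nbr i X) y∈
    ... | i , _ , refl = nbr-flips i X (cong Cell.ori (sym X≡y))

loser-1 : ∀ b → 0 < b → ¬ Winner 1 b T43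
loser-1 = pairingLoser (Fin.zero ∷ []) ([] ∷ [])

loser-2 : ∀ b → 3 < b → ¬ Winner 2 b T43
loser-2 = pairingLoser (Fin.zero ∷ Fin.suc Fin.zero ∷ []) (((λ ()) ∷ []) ∷ [] ∷ [])

loser-3 : ∀ b → 8 < b → ¬ Winner 3 b T43
loser-3 = pairingLoser (allFin 3) (((λ ()) ∷ (λ ()) ∷ []) ∷ ((λ ()) ∷ []) ∷ [] ∷ [])

unique? : ∀ S → Dec (Unique S)
unique? = AllPairs.allPairs? (λ c d → ¬? (c ≟ᶜ d))

valid? : ∀ n marked mv → Dec (ValidMove n marked mv)
valid? n marked mv = (length mv ℕ.≟ n) ×-dec unique? mv ×-dec All.all? (λ c → ¬? (c ∈? marked)) mv

disjoint? : ∀ S T → Dec (Disjoint S T)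
disjoint? S T with All.all? (λ c → ¬? (c ∈? T)) S
... | yes S∉T = yes λ (c∈S , c∈T) → All.lookup S∉T c∈S c∈T
... | no ¬S∉T = no λ disj → ¬S∉T (All.tabulate λ c∈S c∈T → disj (c∈S , c∈T))

winBy : ∀ {a b M B} mv X → ValidMove a (M ++ B) mv → claw X ⊆ mv ++ M → MakerWins a b T43 M B
winBy mv X valid claw⊆ = win mv valid (claw⇒copy _ X claw⊆)

record Threat (a : ℕ) (M S : List Cell) : Set where
  constructor threat
  field
    size      : length S ≡ a
    distinct  : Unique S
    unclaimed : All (_∉ M) S
    centre    : Cell
    completes : claw centre ⊆ S ++ M

stillUnmarked : ∀ {S M B} bv → All (_∉ M) S → hits S bv ≡ 0 → All (_∉ B) S → All (_∉ M ++ bv ++ B) S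
stillUnmarked {S} {M} {B} bv ∉M none ∉B = All.tabulate unmarked
  where
  unmarked : ∀ {c} → c ∈ S → c ∉ M ++ bv ++ B
  unmarked c∈ c∈′ with ∈ₚ.∈-++⁻ M c∈′
  ... | inj₁ c∈M  = All.lookup ∉M c∈ c∈M
  ... | inj₂ c∈B′ with ∈ₚ.∈-++⁻ bv c∈B′
  ...   | inj₁ c∈bv = hits≡0⇒∉ none c∈ c∈bv
  ...   | inj₂ c∈B  = All.lookup ∉B c∈ c∈B

-- More pairwise disjoint threats than Breaker can hit in one move win:
-- after Breaker's move bv one of them is untouched and Maker plays it.
threatsWin : ∀ {a b M B} Ss → AllPairs Disjoint Ss → All (Threat a M) Ss → All (All (_∉ B)) Ss →
             ∀ bv → length bv ≡ b → b < length Ss → MakerWins a b T43 M (bv ++ B)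
threatsWin {M = M} {B} Ss disj threats free bv |bv| many with find (pigeonhole Ss disj bv (subst (_< _) (sym |bv|) many))
... | S , S∈ , untouched = winBy S (Threat.centre t)
      (Threat.size t , Threat.distinct t , stillUnmarked bv (Threat.unclaimed t) untouched (All.lookup free S∈))
      (Threat.completes t)
  where t = All.lookup threats S∈

origin : Cell
origin = cell (+ 0) (+ 0) up

winner-1-0 : Winner 1 0 T43
winner-1-0 = step (origin ∷ []) (toWitness {a? = valid? 1 [] _} tt) λ
  { [] _ → step (cell (+ 0) (+ 0) down ∷ []) (toWitness {a? = valid? 1 _ _} tt) λ
    { [] _ → step (cell -[1+ 0 ] (+ 0) down ∷ []) (toWitness {a? = valid? 1 _ _} tt) λ
      { [] _ → winBy (cell (+ 0) -[1+ 0 ] down ∷ []) origin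
                 (toWitness {a? = valid? 1 _ _} tt) (toWitness {a? = _ ⊆? _} tt)
      ; (_ ∷ _) (() , _) }
    ; (_ ∷ _) (() , _) }
  ; (_ ∷ _) (() , _) }

winner-big : ∀ n → n ≥ 4 → InfiniteThreshold T43 n
winner-big n n≥4 b with freshMove (claw origin) (n ℕ.∸ 4)
... | filler , |filler| , distinct , unclaimed =
  winBy (claw origin ++ filler) origin
    (trans (Listₚ.length-++ (claw origin) {filler}) (trans (cong (4 ℕ.+_) |filler|) (ℕₚ.m+[n∸m]≡n n≥4)) ,
     Uniqueₚ.++⁺ (toWitness {a? = unique? (claw origin)} tt) distinct
       (λ (c∈claw , c∈filler) → All.lookup unclaimed c∈filler c∈claw) ,
     All.tabulate (λ _ ()))
    (All.tabulate (λ c∈ → ∈ₚ.∈-++⁺ˡ {ys = []} (∈ₚ.∈-++⁺ˡ {ys = filler} c∈)))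

-- (3,8): Maker takes three far-apart up cells g.  For each of the nine
-- neighbours Y of these cells, the remaining three cells of the claw at Y
-- form a threat; the nine threats are pairwise disjoint, so Breaker's eight
-- cells miss one of them.
private
  spread : List Cell
  spread = cell (+ 0) (+ 0) up ∷ cell (+ 10) (+ 0) up ∷ cell (+ 20) (+ 0) up ∷ []

  completion : Cell → Cell → List Cell
  completion g Y = Y ∷ filter (λ c → ¬? (c ≟ᶜ g)) (nbrs Y)

  threats38 : List (List Cell)
  threats38 = concatMap (λ g → map (completion g) (nbrs g)) spread

  ThreatAmong : ℕ → List Cell → List Cell → List Cell → Set
  ThreatAmong a M Ys S =
    (length S ≡ a) × Unique S × All (_∉ M) S × Any (λ Y → claw Y ⊆ S ++ M) Ys

  threatAmong? : ∀ a M Ys S → Dec (ThreatAmong a M Ys S)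
  threatAmong? a M Ys S = (length S ℕ.≟ a) ×-dec unique? S ×-dec All.all? (λ c → ¬? (c ∈? M)) S
                          ×-dec Any.any? (λ Y → claw Y ⊆? S ++ M) Ys

  among⇒threat : ∀ {a M Ys S} → ThreatAmong a M Ys S → Threat a M S
  among⇒threat (size , distinct , unclaimed , some) =
    let Y , _ , claw⊆ = find some in threat size distinct unclaimed Y claw⊆

winner-3-8 : Winner 3 8 T43
winner-3-8 = step spread (toWitness {a? = valid? 3 [] spread} tt) λ bv valid →
  threatsWin threats38
    (toWitness {a? = AllPairs.allPairs? disjoint? threats38} tt)
    (All.map among⇒threat
      (toWitness {a? = All.all? (threatAmong? 3 (spread ++ []) (concatMap nbrs spread)) threats38} tt))
    (All.tabulate (λ _ → All.tabulate (λ _ ())))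
    bv (proj₁ valid) ℕₚ.≤-refl

▲ ▼ : ℕ → ℕ → Cell
▲ x y = cell (+ x) (+ y) up
▼ x y = cell (+ x) (+ y) down

-- A spot: once Maker owns the cells hub and anchor of an option, claiming
-- key creates two threats: pair₁ completes the claw at centre₁ and pair₂ the
-- claw at centre₂.
record Spot : Set where
  constructor spot
  field
    key centre₁ centre₂ : Cell
    pair₁ pair₂         : List Cell
open Spot

spotCells : Spot → List Cell
spotCells s = key s ∷ pair₁ s ++ pair₂ s

-- An option grows from a Maker cell hub: Maker prepares it by claiming
-- anchor, and then any of its spots can be played.
record Option : Set where
  constructor option
  field
    hub anchor : Cell
    region     : List Cell
    spots      : List Spot
open Option

zone : Option → List Cell
zone o = anchor o ∷ region o

record Apart (o o' : Option) : Set where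
  constructor apart
  field disjoint : Disjoint (zone o) (zone o')

record SpotOK (o : Option) (s : Spot) : Set where
  field
    anchor∉    : anchor o ∉ spotCells s
    completes₁ : claw (centre₁ s) ⊆ pair₁ s ++ key s ∷ hub o ∷ anchor o ∷ []
    completes₂ : claw (centre₂ s) ⊆ pair₂ s ++ key s ∷ hub o ∷ anchor o ∷ []
    pairsApart : Disjoint (pair₁ s) (pair₂ s)
    key∉₁      : key s ∉ pair₁ s
    key∉₂      : key s ∉ pair₂ s
    size₁      : length (pair₁ s) ≡ 2
    size₂      : length (pair₂ s) ≡ 2
    distinct₁  : Unique (pair₁ s)
    distinct₂  : Unique (pair₂ s)

spotOK? : ∀ o s → Dec (SpotOK o s)
spotOK? o s = Dec.map′
  (λ (a , c₁ , c₂ , d , k₁ , k₂ , l₁ , l₂ , u₁ , u₂) → record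
     { anchor∉ = a ; completes₁ = c₁ ; completes₂ = c₂ ; pairsApart = λ {c} → d {c}
     ; key∉₁ = k₁ ; key∉₂ = k₂ ; size₁ = l₁ ; size₂ = l₂ ; distinct₁ = u₁ ; distinct₂ = u₂ })
  (λ ok → let open SpotOK ok in
     anchor∉ , completes₁ , completes₂ , (λ {c} → pairsApart {c}) , key∉₁ , key∉₂ ,
     size₁ , size₂ , distinct₁ , distinct₂)
  (¬? (anchor o ∈? spotCells s)
   ×-dec claw (centre₁ s) ⊆? pair₁ s ++ key s ∷ hub o ∷ anchor o ∷ []
   ×-dec claw (centre₂ s) ⊆? pair₂ s ++ key s ∷ hub o ∷ anchor o ∷ []
   ×-dec disjoint? (pair₁ s) (pair₂ s)
   ×-dec ¬? (key s ∈? pair₁ s) ×-dec ¬? (key s ∈? pair₂ s)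
   ×-dec length (pair₁ s) ℕ.≟ 2 ×-dec length (pair₂ s) ℕ.≟ 2
   ×-dec unique? (pair₁ s) ×-dec unique? (pair₂ s))

-- All spots are sound and lie in the zone, and each cell of the zone is
-- avoided by some spot; so a single Breaker cell in the zone never spoils
-- all spots.
record OptionOK (o : Option) : Set where
  field
    spotsOK     : All (SpotOK o) (spots o)
    spotsInZone : All (λ s → spotCells s ⊆ zone o) (spots o)
    robust      : All (λ e → Any (λ s → e ∉ spotCells s) (spots o)) (zone o)
open OptionOK

optionOK? : ∀ o → Dec (OptionOK o)
optionOK? o = Dec.map′ (λ (ok , z , r) → record { spotsOK = ok ; spotsInZone = z ; robust = r })
  (λ ok → spotsOK ok , spotsInZone ok , robust ok)
  (All.all? (spotOK? o) (spots o) ×-dec All.all? (λ s → spotCells s ⊆? zone o) (spots o)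
   ×-dec All.all? (λ e → Any.any? (λ s → ¬? (e ∈? spotCells s)) (spots o)) (zone o))

spot⊆zone : ∀ {o s} → OptionOK o → s ∈ spots o → spotCells s ⊆ zone o
spot⊆zone ok s∈ = All.lookup (spotsInZone ok) s∈

translateSpot : Pt → Spot → Spot
translateSpot t (spot k c₁ c₂ p₁ p₂) =
  spot (translate t k) (translate t c₁) (translate t c₂) (map (translate t) p₁) (map (translate t) p₂)

translateOption : Pt → Option → Option
translateOption t (option h a r ss) =
  option (translate t h) (translate t a) (map (translate t) r) (map (translateSpot t) ss)

baseOptions : List Option
baseOptions =
  option (▲ 3 3) (▲ 4 1)
    (▼ 3 1 ∷ ▲ 3 1 ∷ ▼ 3 2 ∷ ▲ 3 2 ∷ ▼ 4 0 ∷ ▼ 4 1 ∷ ▲ 4 2 ∷ ▲ 5 1 ∷ [])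
    ( spot (▼ 3 1) (▼ 3 1) (▲ 4 1) (▲ 3 1 ∷ ▲ 3 2 ∷ []) (▼ 4 0 ∷ ▼ 4 1 ∷ [])
    ∷ spot (▲ 4 2) (▼ 3 2) (▼ 4 1) (▼ 3 2 ∷ ▲ 3 2 ∷ []) (▼ 4 1 ∷ ▲ 5 1 ∷ [])
    ∷ spot (▼ 4 1) (▼ 4 1) (▲ 4 1) (▲ 4 2 ∷ ▲ 5 1 ∷ []) (▼ 3 1 ∷ ▼ 4 0 ∷ [])
    ∷ spot (▲ 3 2) (▼ 3 2) (▼ 3 1) (▼ 3 2 ∷ ▲ 4 2 ∷ []) (▼ 3 1 ∷ ▲ 3 1 ∷ [])
    ∷ [])
  ∷
  option (▲ 3 3) (▲ 4 4)
    (▼ 3 3 ∷ ▼ 3 4 ∷ ▲ 3 4 ∷ ▲ 3 5 ∷ ▼ 4 3 ∷ ▲ 4 3 ∷ ▼ 4 4 ∷ ▲ 5 3 ∷ [])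
    ( spot (▲ 3 4) (▼ 3 4) (▼ 3 3) (▼ 3 4 ∷ ▲ 3 5 ∷ []) (▼ 3 3 ∷ ▲ 4 3 ∷ [])
    ∷ spot (▼ 3 4) (▼ 3 4) (▲ 4 4) (▲ 3 4 ∷ ▲ 3 5 ∷ []) (▼ 4 3 ∷ ▼ 4 4 ∷ [])
    ∷ spot (▲ 4 3) (▼ 4 3) (▼ 3 3) (▼ 4 3 ∷ ▲ 5 3 ∷ []) (▼ 3 3 ∷ ▲ 3 4 ∷ [])
    ∷ spot (▼ 4 3) (▼ 4 3) (▲ 4 4) (▲ 4 3 ∷ ▲ 5 3 ∷ []) (▼ 3 4 ∷ ▼ 4 4 ∷ [])
    ∷ [])
  ∷
  option (▲ 3 3) (▲ 1 4)
    (▼ 0 4 ∷ ▼ 1 3 ∷ ▲ 1 3 ∷ ▼ 1 4 ∷ ▲ 1 5 ∷ ▼ 2 3 ∷ ▲ 2 3 ∷ ▲ 2 4 ∷ [])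
    ( spot (▼ 1 3) (▼ 1 3) (▲ 1 4) (▲ 1 3 ∷ ▲ 2 3 ∷ []) (▼ 0 4 ∷ ▼ 1 4 ∷ [])
    ∷ spot (▲ 2 3) (▼ 2 3) (▼ 1 3) (▼ 2 3 ∷ ▲ 2 4 ∷ []) (▼ 1 3 ∷ ▲ 1 3 ∷ [])
    ∷ spot (▲ 2 4) (▼ 1 4) (▼ 2 3) (▼ 1 4 ∷ ▲ 1 5 ∷ []) (▼ 2 3 ∷ ▲ 2 3 ∷ [])
    ∷ spot (▼ 1 4) (▼ 1 4) (▲ 1 4) (▲ 1 5 ∷ ▲ 2 4 ∷ []) (▼ 0 4 ∷ ▼ 1 3 ∷ [])
    ∷ [])
  ∷ []

-- The options at an up cell g, translated from the table.  Kept opaque so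
-- that type checking never unfolds the table except in the one computation
-- that verifies the opening.
opaque
  optionsAt : Cell → List Option
  optionsAt g = map (translateOption (Cell.cx g ℤ.- + 3 , Cell.cy g ℤ.- + 3)) baseOptions

  length-optionsAt : ∀ g → length (optionsAt g) ≡ 3
  length-optionsAt g =
    Listₚ.length-map (translateOption (Cell.cx g ℤ.- + 3 , Cell.cy g ℤ.- + 3)) baseOptions

Untouched : List Cell → Spot → Set
Untouched B s = All (_∉ B) (spotCells s)

untouchedSpot : ∀ {o B} → OptionOK o → hits (zone o) B ≤ 1 → Σ Spot λ s → s ∈ spots o × Untouched B s
untouchedSpot {o} {B} ok ≤1 with Any.any? (_∈? B) (zone o)
... | no ¬hit = let s , s∈ , _ = find (All.lookup (robust ok) (here refl)) in
    s , s∈ , All.tabulate λ c∈ c∈B → ¬hit (lose (All.lookup (spot⊆zone ok s∈) c∈) c∈B)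
... | yes hit with find hit
...   | e , e∈zone , e∈B with find (All.lookup (robust ok) e∈zone)
...     | s , s∈ , e∉s = s , s∈ , All.tabulate λ {c} c∈ c∈B →
            e∉s (subst (_∈ spotCells s)
                       (hits≤1⇒same B ≤1 (All.lookup (spot⊆zone ok s∈) c∈) c∈B e∈zone e∈B) c∈)

record Prepared (o : Option) (M : List Cell) : Set where
  field
    ok         : OptionOK o
    hub∈       : hub o ∈ M
    anchor∈    : anchor o ∈ M
    onlyAnchor : ∀ {m} → m ∈ M → m ∈ zone o → m ≡ anchor o

record Fresh (o : Option) (M B : List Cell) : Set where
  field
    ok        : OptionOK o
    hub∈      : hub o ∈ M
    outside   : ∀ {m} → m ∈ M → m ∉ zone o
    untouched : hits (zone o) B ≡ 0

spot∩maker : ∀ {o s M c} → Prepared o M → s ∈ spots o → SpotOK o s → c ∈ spotCells s → c ∉ M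
spot∩maker {o} {s} prep s∈ sok c∈ c∈M = SpotOK.anchor∉ sok (subst (_∈ spotCells s) c≡anchor c∈)
  where
  c≡anchor = Prepared.onlyAnchor prep c∈M (All.lookup (spot⊆zone (Prepared.ok prep) s∈) c∈)

pair₁⊆ : ∀ t → pair₁ t ⊆ spotCells t
pair₁⊆ t = All.tabulate λ x∈ → there (∈ₚ.∈-++⁺ˡ x∈)

pair₂⊆ : ∀ t → pair₂ t ⊆ spotCells t
pair₂⊆ t = All.tabulate λ x∈ → there (∈ₚ.∈-++⁺ʳ (pair₁ t) x∈)

Win : List Cell → List Cell → Set
Win M B = MakerWins 2 3 T43 M B

-- Fork: with two prepared options in disjoint zones, each with an untouched
-- spot, Maker claims both keys.  This creates four pairwise disjoint threats,
-- more than Breaker's three cells can spoil.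
module Fork {M B o o' s s'} (prep : Prepared o M) (prep' : Prepared o' M) (sep : Apart o o')
  (s∈ : s ∈ spots o) (s'∈ : s' ∈ spots o') (free : Untouched B s) (free' : Untouched B s') where

  sok : SpotOK o s
  sok = All.lookup (spotsOK (Prepared.ok prep)) s∈
  sok' : SpotOK o' s'
  sok' = All.lookup (spotsOK (Prepared.ok prep')) s'∈

  keys : List Cell
  keys = key s ∷ key s' ∷ []

  across : ∀ {c c'} → c ∈ spotCells s → c' ∈ spotCells s' → c ≢ c'
  across c∈ c'∈ refl = Apart.disjoint sep
    (All.lookup (spot⊆zone (Prepared.ok prep) s∈) c∈ , All.lookup (spot⊆zone (Prepared.ok prep') s'∈) c'∈)

  keysValid : ValidMove 2 (M ++ B) keys
  keysValid = refl , ((across (here refl) (here refl) ∷ []) ∷ [] ∷ []) ,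
    unmarked prep s∈ sok free ∷ unmarked prep' s'∈ sok' free' ∷ []
    where
    unmarked : ∀ {o s} → Prepared o M → s ∈ spots o → SpotOK o s → Untouched B s → key s ∉ M ++ B
    unmarked prep s∈ sok free k∈ with ∈ₚ.∈-++⁻ M k∈
    ... | inj₁ k∈M = spot∩maker prep s∈ sok (here refl) k∈M
    ... | inj₂ k∈B = All.lookup free (here refl) k∈B

  avoidKeys : ∀ {p} → p ⊆ spotCells s → key s ∉ p → All (_∉ keys) p
  avoidKeys p⊆ key∉ = All.tabulate λ
    { x∈ (here refl)         → key∉ x∈
    ; x∈ (there (here refl)) → across (All.lookup p⊆ x∈) (here refl) refl }
  avoidKeys' : ∀ {p} → p ⊆ spotCells s' → key s' ∉ p → All (_∉ keys) p
  avoidKeys' p⊆ key∉ = All.tabulate λ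
    { x∈ (here refl)         → across (here refl) (All.lookup p⊆ x∈) refl
    ; x∈ (there (here refl)) → key∉ x∈ }

  pairThreat : ∀ {u t p c} → Prepared u M → t ∈ spots u → SpotOK u t → key t ∈ keys →
               p ⊆ spotCells t → All (_∉ keys) p → length p ≡ 2 → Unique p →
               claw c ⊆ p ++ key t ∷ hub u ∷ anchor u ∷ [] → Threat 2 (keys ++ M) p
  pairThreat {u} {t} {p} {c} prep t∈ tok key∈ p⊆ p∉keys size distinct completes =
    threat size distinct (All.tabulate unclaimed) c (All.map widen completes)
    where
    unclaimed : ∀ {x} → x ∈ p → x ∉ keys ++ M
    unclaimed {x} x∈ x∈′ with ∈ₚ.∈-++⁻ keys x∈′
    ... | inj₁ x∈keys = All.lookup p∉keys x∈ x∈keys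
    ... | inj₂ x∈M    = spot∩maker {u} {t} prep t∈ tok (All.lookup p⊆ x∈) x∈M
    widen : ∀ {x} → x ∈ p ++ key t ∷ hub u ∷ anchor u ∷ [] → x ∈ p ++ keys ++ M
    widen x∈ with ∈ₚ.∈-++⁻ p x∈
    ... | inj₁ x∈p                         = ∈ₚ.∈-++⁺ˡ x∈p
    ... | inj₂ (here refl)                 = ∈ₚ.∈-++⁺ʳ p (∈ₚ.∈-++⁺ˡ key∈)
    ... | inj₂ (there (here refl))         = ∈ₚ.∈-++⁺ʳ p (∈ₚ.∈-++⁺ʳ keys (Prepared.hub∈ prep))
    ... | inj₂ (there (there (here refl))) = ∈ₚ.∈-++⁺ʳ p (∈ₚ.∈-++⁺ʳ keys (Prepared.anchor∈ prep))

  threats : List (List Cell)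
  threats = pair₁ s ∷ pair₂ s ∷ pair₁ s' ∷ pair₂ s' ∷ []

  threatsOK : All (Threat 2 (keys ++ M)) threats
  threatsOK =
    pairThreat prep s∈ sok (here refl) (pair₁⊆ s) (avoidKeys (pair₁⊆ s) key∉₁) size₁ distinct₁ completes₁ ∷
    pairThreat prep s∈ sok (here refl) (pair₂⊆ s) (avoidKeys (pair₂⊆ s) key∉₂) size₂ distinct₂ completes₂ ∷
    pairThreat prep' s'∈ sok' (there (here refl)) (pair₁⊆ s') (avoidKeys' (pair₁⊆ s') key∉₁')
      size₁' distinct₁' completes₁' ∷
    pairThreat prep' s'∈ sok' (there (here refl)) (pair₂⊆ s') (avoidKeys' (pair₂⊆ s') key∉₂')
      size₂' distinct₂' completes₂' ∷ []
    where
    open SpotOK sok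
    open SpotOK sok' renaming (key∉₁ to key∉₁'; key∉₂ to key∉₂'; size₁ to size₁'; size₂ to size₂';
      distinct₁ to distinct₁'; distinct₂ to distinct₂'; completes₁ to completes₁'; completes₂ to completes₂')

  threatsApart : AllPairs Disjoint threats
  threatsApart =
    (SpotOK.pairsApart sok ∷ cross (pair₁⊆ s) (pair₁⊆ s') ∷ cross (pair₁⊆ s) (pair₂⊆ s') ∷ []) ∷
    (cross (pair₂⊆ s) (pair₁⊆ s') ∷ cross (pair₂⊆ s) (pair₂⊆ s') ∷ []) ∷
    (SpotOK.pairsApart sok' ∷ []) ∷ [] ∷ []
    where
    cross : ∀ {p q} → p ⊆ spotCells s → q ⊆ spotCells s' → Disjoint p q
    cross p⊆ q⊆ (x∈p , x∈q) = across (All.lookup p⊆ x∈p) (All.lookup q⊆ x∈q) refl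

  threatsFree : All (All (_∉ B)) threats
  threatsFree = fromSpot s free (pair₁⊆ s) ∷ fromSpot s free (pair₂⊆ s) ∷
                fromSpot s' free' (pair₁⊆ s') ∷ fromSpot s' free' (pair₂⊆ s') ∷ []
    where
    fromSpot : ∀ t {p} → Untouched B t → p ⊆ spotCells t → All (_∉ B) p
    fromSpot t free p⊆ = All.map (All.lookup free) p⊆

  wins : Win M B
  wins = step keys keysValid λ bv valid →
    threatsWin threats threatsApart threatsOK threatsFree bv (proj₁ valid) ℕₚ.≤-refl

anchors : Option → Option → List Cell
anchors o o' = anchor o ∷ anchor o' ∷ []

anchor∉ˡ : ∀ {o o'} → Apart o o' → anchor o ∉ zone o'
anchor∉ˡ sep a∈ = Apart.disjoint sep (here refl , a∈)

anchor∉ʳ : ∀ {o o'} → Apart o o' → anchor o' ∉ zone o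
anchor∉ʳ sep a∈ = Apart.disjoint sep (a∈ , here refl)

prepareValid : ∀ {M B o o'} → Fresh o M B → Fresh o' M B → Apart o o' → ValidMove 2 (M ++ B) (anchors o o')
prepareValid {M} {B} {o} {o'} fresh fresh' sep =
  refl , ((λ eq → anchor∉ˡ sep (subst (_∈ zone o') (sym eq) (here refl))) ∷ []) ∷ [] ∷ [] ,
  unmarked fresh ∷ unmarked fresh' ∷ []
  where
  unmarked : ∀ {u} → Fresh u M B → anchor u ∉ M ++ B
  unmarked fresh a∈ with ∈ₚ.∈-++⁻ M a∈
  ... | inj₁ a∈M = Fresh.outside fresh a∈M (here refl)
  ... | inj₂ a∈B = hits≡0⇒∉ (Fresh.untouched fresh) (here refl) a∈B

module _ {M : List Cell} {o o' : Option} (sep : Apart o o') where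
  private
    M' = anchors o o' ++ M

    fromFresh : ∀ {u B} → Fresh u M B → anchor u ∈ anchors o o' →
                (∀ {m} → m ∈ anchors o o' → m ∈ zone u → m ≡ anchor u) → Prepared u M'
    fromFresh {u} fresh a∈ own = record
      { ok = Fresh.ok fresh ; hub∈ = ∈ₚ.∈-++⁺ʳ _ (Fresh.hub∈ fresh) ; anchor∈ = ∈ₚ.∈-++⁺ˡ a∈
      ; onlyAnchor = λ m∈ m∈zone → case-++ m∈ m∈zone }
      where
      case-++ : ∀ {m} → m ∈ M' → m ∈ zone u → m ≡ anchor u
      case-++ m∈ m∈zone with ∈ₚ.∈-++⁻ (anchors o o') m∈
      ... | inj₁ m∈new = own m∈new m∈zone
      ... | inj₂ m∈M   = ⊥-elim (Fresh.outside fresh m∈M m∈zone)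

  prepared₁ : ∀ {B} → Fresh o M B → Prepared o M'
  prepared₁ fresh = fromFresh fresh (here refl)
    λ { (here refl) _ → refl ; (there (here refl)) a∈ → ⊥-elim (anchor∉ʳ sep a∈) }

  prepared₂ : ∀ {B} → Fresh o' M B → Prepared o' M'
  prepared₂ fresh = fromFresh fresh (there (here refl))
    λ { (here refl) a∈ → ⊥-elim (anchor∉ˡ sep a∈) ; (there (here refl)) _ → refl }

  stillPrepared : ∀ {Y} → Prepared Y M → Apart Y o → Apart Y o' → Prepared Y M'
  stillPrepared {Y} prep Yo Yo' = record
    { ok = Prepared.ok prep ; hub∈ = there (there (Prepared.hub∈ prep))
    ; anchor∈ = there (there (Prepared.anchor∈ prep)) ; onlyAnchor = own }
    where
    own : ∀ {m} → m ∈ M' → m ∈ zone Y → m ≡ anchor Y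
    own (here refl)         m∈zone = ⊥-elim (anchor∉ʳ Yo m∈zone)
    own (there (here refl)) m∈zone = ⊥-elim (anchor∉ʳ Yo' m∈zone)
    own (there (there m∈M)) m∈zone = Prepared.onlyAnchor prep m∈M m∈zone

  stillFresh : ∀ {x B B'} → Fresh x M B → Apart o x → Apart o' x → hits (zone x) B' ≡ 0 → Fresh x M' B'
  stillFresh {x} fresh ox o'x clean = record
    { ok = Fresh.ok fresh ; hub∈ = there (there (Fresh.hub∈ fresh)) ; outside = out ; untouched = clean }
    where
    out : ∀ {m} → m ∈ M' → m ∉ zone x
    out (here refl)         = anchor∉ˡ ox
    out (there (here refl)) = anchor∉ˡ o'x
    out (there (there m∈M)) = Fresh.outside fresh m∈M

roundBound : ∀ B Ss → AllPairs Disjoint Ss → All (λ S → hits S B ≡ 0) Ss →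
             ∀ bv → length bv ≡ 3 → sumOver (λ S → hits S (bv ++ B)) Ss ≤ 3
roundBound B Ss disj clean bv |bv| =
  subst (_≤ 3) (sym (after Ss clean)) (ℕₚ.≤-trans (hits-disjoint-family Ss disj bv) (ℕₚ.≤-reflexive |bv|))
  where
  after : ∀ Ss → All (λ S → hits S B ≡ 0) Ss →
          sumOver (λ S → hits S (bv ++ B)) Ss ≡ sumOver (λ S → hits S bv) Ss
  after []       []             = refl
  after (S ∷ Ss) (none ∷ nones) = cong₂ ℕ._+_ (hits-after S bv none) (after Ss nones)

zones : ∀ {os} → AllPairs Apart os → AllPairs Disjoint (map zone os)
zones = AllPairsₚ.map⁺ ∘ AllPairs.map Apart.disjoint

-- Arithmetic for the case analyses on how Breaker spreads his cells.  A
-- zone is light if it holds at most one Breaker cell and heavy otherwise.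
light-or-heavy : ∀ n → n ≤ 1 ⊎ 2 ≤ n
light-or-heavy 0 = inj₁ z≤n
light-or-heavy 1 = inj₁ (s≤s z≤n)
light-or-heavy (ℕ.suc (ℕ.suc n)) = inj₂ (s≤s (s≤s z≤n))

zero-or-hit : ∀ n → n ≡ 0 ⊎ 1 ≤ n
zero-or-hit 0           = inj₁ refl
zero-or-hit (ℕ.suc n) = inj₂ (s≤s z≤n)

drop-heavy : ∀ k n a {r} → k ≤ a → a ℕ.+ r ≤ k ℕ.+ n → r ≤ n
drop-heavy k n a {r} k≤a bound = ℕₚ.+-cancelˡ-≤ k r n (ℕₚ.≤-trans (ℕₚ.+-monoˡ-≤ r k≤a) bound)

drop-heavy₂ : ∀ k n a b {r} → k ≤ b → a ℕ.+ (b ℕ.+ r) ≤ k ℕ.+ n → a ℕ.+ r ≤ n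
drop-heavy₂ k n a b {r} k≤b bound = drop-heavy k n b k≤b (subst (_≤ k ℕ.+ n) (x∙yz≈y∙xz a b r) bound)

nothing-left : ∀ a {r} → a ℕ.+ r ≤ 0 → a ≡ 0 × r ≤ 0
nothing-left a bound = ℕₚ.n≤0⇒n≡0 (ℕₚ.m+n≤o⇒m≤o a bound) , ℕₚ.m+n≤o⇒n≤o a bound

light₂ : ∀ a {r} → a ℕ.+ r ≤ 1 → a ≤ 1 × r ≤ 1
light₂ a bound = ℕₚ.m+n≤o⇒m≤o a bound , ℕₚ.m+n≤o⇒n≤o a bound

last : ∀ {a n} → a ℕ.+ 0 ≤ n → a ≤ n
last {a} = ℕₚ.≤-trans (ℕₚ.m≤m+n a 0)

forkLight : ∀ {M B o o'} → Prepared o M → Prepared o' M → Apart o o' →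
            hits (zone o) B ≤ 1 → hits (zone o') B ≤ 1 → Win M B
forkLight prep prep' sep ≤1 ≤1'
  with untouchedSpot (Prepared.ok prep) ≤1 | untouchedSpot (Prepared.ok prep') ≤1'
... | s , s∈ , free | s' , s'∈ , free' = Fork.wins prep prep' sep s∈ s'∈ free free'

forkArmed : ∀ {M B o o' s} → Prepared o M → s ∈ spots o → Untouched B s →
            Prepared o' M → Apart o o' → hits (zone o') B ≤ 1 → Win M B
forkArmed prep s∈ free prep' sep ≤1' with untouchedSpot (Prepared.ok prep') ≤1'
... | s' , s'∈ , free' = Fork.wins prep prep' sep s∈ s'∈ free free'

-- Maker prepares the fresh ones; Breaker's three cells leave two of the
-- three zones with at most one hit, and Maker forks with those.
endgame : ∀ {M B Y e f} → Prepared Y M → hits (zone Y) B ≡ 0 → Fresh e M B → Fresh f M B →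
          AllPairs Apart (Y ∷ e ∷ f ∷ []) → Win M B
endgame {M} {B} {Y} {e} {f} prepY cleanY fresh-e fresh-f sep@((Ye ∷ Yf ∷ []) ∷ (ef ∷ []) ∷ [] ∷ []) =
  step (anchors e f) (prepareValid fresh-e fresh-f ef) next
  where
  prepY' = stillPrepared ef prepY Ye Yf
  prep-e = prepared₁ ef fresh-e
  prep-f = prepared₂ ef fresh-f
  next : ∀ bv → ValidMove 3 (anchors e f ++ M ++ B) bv → Win (anchors e f ++ M) (bv ++ B)
  next bv valid = decide (light-or-heavy hY) (light-or-heavy hE)
    where
    hY = hits (zone Y) (bv ++ B)
    hE = hits (zone e) (bv ++ B)
    hF = hits (zone f) (bv ++ B)
    bound : hY ℕ.+ (hE ℕ.+ (hF ℕ.+ 0)) ≤ 3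
    bound = roundBound B (map zone (Y ∷ e ∷ f ∷ [])) (zones sep)
              (cleanY ∷ Fresh.untouched fresh-e ∷ Fresh.untouched fresh-f ∷ []) bv (proj₁ valid)
    decide : hY ≤ 1 ⊎ 2 ≤ hY → hE ≤ 1 ⊎ 2 ≤ hE → Win (anchors e f ++ M) (bv ++ B)
    decide (inj₁ lY) (inj₁ lE) = forkLight prepY' prep-e Ye lY lE
    decide (inj₁ lY) (inj₂ HE) =
      forkLight prepY' prep-f Yf lY (last (proj₂ (light₂ hY (drop-heavy₂ 2 1 hY hE HE bound))))
    decide (inj₂ HY) _         = let lE , lF = light₂ hE (drop-heavy 2 1 hY HY bound) in
                                 forkLight prep-e prep-f ef lE (last lF)

-- Maker prepares c and d.  If Breaker leaves s alone, Maker forks with Y and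
-- whichever of c, d is still light.  Otherwise at most two Breaker cells went
-- to c, d, e, f: either c and d are both light (fork), or one of them took
-- both and the endgame is reached with the other one and e, f.
armedAndFour : ∀ {M B Y s c d e f} → Prepared Y M → s ∈ spots Y → Untouched B s →
               Fresh c M B → Fresh d M B → Fresh e M B → Fresh f M B →
               AllPairs Apart (Y ∷ c ∷ d ∷ e ∷ f ∷ []) → Win M B
armedAndFour {M} {B} {Y} {s} {c} {d} {e} {f} prepY s∈ free fresh-c fresh-d fresh-e fresh-f
  ((Yc ∷ Yd ∷ Ye ∷ Yf ∷ []) ∷ rest@((cd ∷ ce ∷ cf ∷ []) ∷ (de ∷ df ∷ []) ∷ (ef ∷ []) ∷ [] ∷ [])) =
  step (anchors c d) (prepareValid fresh-c fresh-d cd) next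
  where
  prepY' = stillPrepared cd prepY Yc Yd
  prep-c = prepared₁ cd fresh-c
  prep-d = prepared₂ cd fresh-d
  regionsApart : AllPairs Disjoint (spotCells s ∷ map zone (c ∷ d ∷ e ∷ f ∷ []))
  regionsApart = Allₚ.map⁺ (All.map {P = Apart Y} {Q = λ o → Disjoint (spotCells s) (zone o)} spotApart
                   (Yc ∷ Yd ∷ Ye ∷ Yf ∷ [])) ∷ zones rest
    where
    spotApart : ∀ {o} → Apart Y o → Disjoint (spotCells s) (zone o)
    spotApart sep (x∈s , x∈o) = Apart.disjoint sep (All.lookup (spot⊆zone (Prepared.ok prepY) s∈) x∈s , x∈o)
  next : ∀ bv → ValidMove 3 (anchors c d ++ M ++ B) bv → Win (anchors c d ++ M) (bv ++ B)
  next bv valid = decide (zero-or-hit hS)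
    where
    B' = bv ++ B
    hS = hits (spotCells s) B'
    hC = hits (zone c) B'
    hD = hits (zone d) B'
    hE = hits (zone e) B'
    hF = hits (zone f) B'
    others = hC ℕ.+ (hD ℕ.+ (hE ℕ.+ (hF ℕ.+ 0)))
    bound : hS ℕ.+ others ≤ 3
    bound = roundBound B (spotCells s ∷ map zone (c ∷ d ∷ e ∷ f ∷ [])) regionsApart
              (free⇒hits≡0 free ∷ Fresh.untouched fresh-c ∷ Fresh.untouched fresh-d
                 ∷ Fresh.untouched fresh-e ∷ Fresh.untouched fresh-f ∷ []) bv (proj₁ valid)
    fresh-e' : hE ≡ 0 → Fresh e (anchors c d ++ M) B'
    fresh-e' = stillFresh cd fresh-e ce de
    fresh-f' : hF ≡ 0 → Fresh f (anchors c d ++ M) B'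
    fresh-f' = stillFresh cd fresh-f cf df
    spotFree : hS ≡ 0 → Untouched B' s
    spotFree none = All.tabulate (hits≡0⇒∉ none)
    decide : hS ≡ 0 ⊎ 1 ≤ hS → Win (anchors c d ++ M) B'
    decide (inj₁ none) with light-or-heavy hC | light-or-heavy hD
    ... | inj₁ lC | _      = forkArmed prepY' s∈ (spotFree none) prep-c Yc lC
    ... | inj₂ _  | inj₁ lD = forkArmed prepY' s∈ (spotFree none) prep-d Yd lD
    ... | inj₂ HC | inj₂ HD =
      let bound′ = subst (λ h → h ℕ.+ others ≤ 3) none bound
      in ⊥-elim (ℕₚ.<⇒≱ HC (proj₁ (light₂ hC (drop-heavy₂ 2 1 hC hD HD bound′))))
    decide (inj₂ hit) with light-or-heavy hC | light-or-heavy hD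
    ... | inj₁ lC | inj₁ lD = forkLight prep-c prep-d cd lC lD
    ... | inj₂ HC | _       =
      let noD , rest′ = nothing-left hD (drop-heavy 2 0 hC HC (drop-heavy 1 2 hS hit bound))
          noE , rest″ = nothing-left hE rest′
          noF , _     = nothing-left hF rest″
      in endgame prep-d noD (fresh-e' noE) (fresh-f' noF) ((de ∷ df ∷ []) ∷ (ef ∷ []) ∷ [] ∷ [])
    ... | inj₁ _  | inj₂ HD =
      let noC , rest′ = nothing-left hC (drop-heavy₂ 2 0 hC hD HD (drop-heavy 1 2 hS hit bound))
          noE , rest″ = nothing-left hE rest′
          noF , _     = nothing-left hF rest″
      in endgame prep-c noC (fresh-e' noE) (fresh-f' noF) ((ce ∷ cf ∷ []) ∷ (ef ∷ []) ∷ [] ∷ [])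

-- After Breaker sacrificed two cells of a round on one option: a prepared
-- option Y and four options that are fresh unless hit, with at most one
-- Breaker cell in all five zones together.  If Y got it, Y is still armed
-- and the other four are fresh; otherwise two of c, d, e are fresh and Y is
-- clean, which is the endgame.
afterSacrifice : ∀ {M B Y c d e f} → Prepared Y M →
  (hits (zone c) B ≡ 0 → Fresh c M B) → (hits (zone d) B ≡ 0 → Fresh d M B) →
  (hits (zone e) B ≡ 0 → Fresh e M B) → (hits (zone f) B ≡ 0 → Fresh f M B) →
  AllPairs Apart (Y ∷ c ∷ d ∷ e ∷ f ∷ []) →
  sumOver (λ S → hits S B) (map zone (Y ∷ c ∷ d ∷ e ∷ f ∷ [])) ≤ 1 →
  Win M B
afterSacrifice {M} {B} {Y} {c} {d} {e} {f} prepY fresh-c fresh-d fresh-e fresh-f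
  sep@((Yc ∷ Yd ∷ Ye ∷ Yf ∷ []) ∷ (cd ∷ ce ∷ cf ∷ []) ∷ (de ∷ df ∷ []) ∷ (ef ∷ []) ∷ [] ∷ []) bound =
  decide (zero-or-hit hY)
  where
  hY = hits (zone Y) B
  hC = hits (zone c) B
  hD = hits (zone d) B
  hE = hits (zone e) B
  hF = hits (zone f) B
  decide : hY ≡ 0 ⊎ 1 ≤ hY → Win M B
  decide (inj₂ hit) =
    let noC , r₁ = nothing-left hC (drop-heavy 1 0 hY hit bound)
        noD , r₂ = nothing-left hD r₁
        noE , r₃ = nothing-left hE r₂
        noF , _  = nothing-left hF r₃
        s , s∈ , free = untouchedSpot (Prepared.ok prepY) (proj₁ (light₂ hY bound))
    in armedAndFour prepY s∈ free (fresh-c noC) (fresh-d noD) (fresh-e noE) (fresh-f noF) sep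
  decide (inj₁ cleanY) with zero-or-hit hC
  ... | inj₂ hitC =
    let noD , r₁ = nothing-left hD (drop-heavy 1 0 hC hitC (subst (λ h → h ℕ.+ _ ≤ 1) cleanY bound))
        noE , _  = nothing-left hE r₁
    in endgame prepY cleanY (fresh-d noD) (fresh-e noE) ((Yd ∷ Ye ∷ []) ∷ (de ∷ []) ∷ [] ∷ [])
  ... | inj₁ noC with zero-or-hit hD
  ...   | inj₁ noD = endgame prepY cleanY (fresh-c noC) (fresh-d noD) ((Yc ∷ Yd ∷ []) ∷ (cd ∷ []) ∷ [] ∷ [])
  ...   | inj₂ hitD =
    let noE , _ = nothing-left hE (drop-heavy 1 0 hD hitD
                    (subst₂ (λ h h' → h ℕ.+ (h' ℕ.+ _) ≤ 1) cleanY noC bound))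
    in endgame prepY cleanY (fresh-c noC) (fresh-e noE) ((Yc ∷ Ye ∷ []) ∷ (ce ∷ []) ∷ [] ∷ [])

-- Maker prepares a and b.
-- If both stay light, he forks; otherwise Breaker spent two of his three
-- cells on one of them, and the other one with c, d, e, f is the situation
-- of afterSacrifice.
sixFresh : ∀ {M B a b c d e f} → Fresh a M B → Fresh b M B → Fresh c M B → Fresh d M B →
           Fresh e M B → Fresh f M B → AllPairs Apart (a ∷ b ∷ c ∷ d ∷ e ∷ f ∷ []) → Win M B
sixFresh {M} {B} {a} {b} {c} {d} {e} {f} fresh-a fresh-b fresh-c fresh-d fresh-e fresh-f
  ((ab ∷ ac ∷ ad ∷ ae ∷ af ∷ []) ∷ tail@((bc ∷ bd ∷ be ∷ bf ∷ []) ∷ rest)) =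
  step (anchors a b) (prepareValid fresh-a fresh-b ab) next
  where
  prep-a = prepared₁ ab fresh-a
  prep-b = prepared₂ ab fresh-b
  next : ∀ bv → ValidMove 3 (anchors a b ++ M ++ B) bv → Win (anchors a b ++ M) (bv ++ B)
  next bv valid = decide (light-or-heavy hA) (light-or-heavy hB)
    where
    B' = bv ++ B
    hA = hits (zone a) B'
    hB = hits (zone b) B'
    bound : sumOver (λ S → hits S B') (map zone (a ∷ b ∷ c ∷ d ∷ e ∷ f ∷ [])) ≤ 3
    bound = roundBound B (map zone (a ∷ b ∷ c ∷ d ∷ e ∷ f ∷ []))
              (zones ((ab ∷ ac ∷ ad ∷ ae ∷ af ∷ []) ∷ tail))
              (Fresh.untouched fresh-a ∷ Fresh.untouched fresh-b ∷ Fresh.untouched fresh-c ∷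
               Fresh.untouched fresh-d ∷ Fresh.untouched fresh-e ∷ Fresh.untouched fresh-f ∷ []) bv (proj₁ valid)
    decide : hA ≤ 1 ⊎ 2 ≤ hA → hB ≤ 1 ⊎ 2 ≤ hB → Win (anchors a b ++ M) B'
    decide (inj₁ lA) (inj₁ lB) = forkLight prep-a prep-b ab lA lB
    decide (inj₂ HA) _ =
      afterSacrifice prep-b (stillFresh ab fresh-c ac bc) (stillFresh ab fresh-d ad bd)
        (stillFresh ab fresh-e ae be) (stillFresh ab fresh-f af bf) tail (drop-heavy 2 1 hA HA bound)
    decide (inj₁ _) (inj₂ HB) =
      afterSacrifice prep-a (stillFresh ab fresh-c ac bc) (stillFresh ab fresh-d ad bd)
        (stillFresh ab fresh-e ae be) (stillFresh ab fresh-f af bf) ((ac ∷ ad ∷ ae ∷ af ∷ []) ∷ rest)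
        (drop-heavy₂ 2 1 hA hB HB bound)

-- Maker's first two cells are hubs far apart on a row; after
-- Breaker's answer one of four further pairs of hubs is untouched and Maker
-- takes it.  The four hubs then carry twelve options in pairwise disjoint
-- zones, and Breaker's six cells spoil at most six of them.
hubAt : ℕ → Cell
hubAt i = ▲ (20 ℕ.* i ℕ.+ 3) 3

firstHubs : List Cell
firstHubs = hubAt 0 ∷ hubAt 1 ∷ []

candidatePairs : List (List Cell)
candidatePairs = (hubAt 2 ∷ hubAt 3 ∷ []) ∷ (hubAt 4 ∷ hubAt 5 ∷ [])
               ∷ (hubAt 6 ∷ hubAt 7 ∷ []) ∷ (hubAt 8 ∷ hubAt 9 ∷ []) ∷ []

record Good (M : List Cell) : Set where
  field
    allApart : AllPairs Apart (concatMap optionsAt M)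
    sound    : All OptionOK (concatMap optionsAt M)
    placed   : All (λ o → hub o ∈ M × All (_∉ zone o) M) (concatMap optionsAt M)

good? : ∀ M → Dec (Good M)
good? M = Dec.map′ (λ (a , s , p) → record { allApart = a ; sound = s ; placed = p })
  (λ g → Good.allApart g , Good.sound g , Good.placed g)
  (AllPairs.allPairs? (λ o o' → Dec.map′ apart Apart.disjoint (disjoint? (zone o) (zone o')))
                      (concatMap optionsAt M)
   ×-dec All.all? optionOK? (concatMap optionsAt M)
   ×-dec All.all? (λ o → hub o ∈? M ×-dec All.all? (λ m → ¬? (m ∈? zone o)) M) (concatMap optionsAt M))

SecondMove : List Cell → Set
SecondMove P = length P ≡ 2 × Unique P × All (_∉ firstHubs) P × Good (P ++ firstHubs)

opaque
  unfolding optionsAt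
  secondMoves : All SecondMove candidatePairs
  secondMoves = toWitness {a? = All.all? (λ P → (length P ℕ.≟ 2) ×-dec unique? P ×-dec
                  All.all? (λ c → ¬? (c ∈? firstHubs)) P ×-dec good? (P ++ firstHubs)) candidatePairs} tt

sixOf : ∀ {M B} os → 6 ≤ length os → All (λ o → Fresh o M B) os → AllPairs Apart os → Win M B
sixOf (a ∷ b ∷ c ∷ d ∷ e ∷ f ∷ _) _ (fa ∷ fb ∷ fc ∷ fd ∷ fe ∷ ff ∷ _) sep =
  sixFresh fa fb fc fd fe ff (AllPairsₚ.take⁺ 6 sep)
sixOf []                      ()
sixOf (_ ∷ [])                (s≤s ())
sixOf (_ ∷ _ ∷ [])            (s≤s (s≤s ()))
sixOf (_ ∷ _ ∷ _ ∷ [])        (s≤s (s≤s (s≤s ())))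
sixOf (_ ∷ _ ∷ _ ∷ _ ∷ [])    (s≤s (s≤s (s≤s (s≤s ()))))
sixOf (_ ∷ _ ∷ _ ∷ _ ∷ _ ∷ []) (s≤s (s≤s (s≤s (s≤s (s≤s ())))))

twelveOptions : ∀ M B → Good M → length M ≡ 4 → length B ≡ 6 → Win M B
twelveOptions M B good |M| |B| =
  sixOf clean manyClean freshClean (AllPairsₚ.filter⁺ clean? (Good.allApart good))
  where
  options = concatMap optionsAt M
  clean? : (o : Option) → Dec (hits (zone o) B ≡ 0)
  clean? o = hits (zone o) B ℕ.≟ 0
  clean = filter clean? options
  dirty = filter (∁? clean?) options
  freshClean : All (λ o → Fresh o M B) clean
  freshClean = All.zipWith (λ ((ok , hub∈ , out) , none) → record
                 { ok = ok ; hub∈ = hub∈ ; outside = λ m∈ → All.lookup out m∈ ; untouched = none })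
               (Allₚ.filter⁺ clean? (All.zip (Good.sound good , Good.placed good)) , Allₚ.all-filter clean? options)
  fewDirty : length dirty ≤ 6
  fewDirty = begin
    length dirty                              ≡⟨ Listₚ.length-map zone dirty ⟨
    length (map zone dirty)                   ≤⟨ sumOver-≥length (λ S → hits S B) (map zone dirty)
                                                   (Allₚ.map⁺ (All.map ℕₚ.n≢0⇒n>0 (Allₚ.all-filter (∁? clean?) options))) ⟩
    sumOver (λ S → hits S B) (map zone dirty) ≤⟨ hits-disjoint-family (map zone dirty)
                                                   (zones (AllPairsₚ.filter⁺ (∁? clean?) (Good.allApart good))) B ⟩
    length B                                  ≡⟨ |B| ⟩
    6                                         ∎
    where open ℕₚ.≤-Reasoning
  manyClean : 6 ≤ length clean
  manyClean = ℕₚ.+-cancelʳ-≤ 6 6 (length clean) (begin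
    12                                  ≡⟨ cong (ℕ._* 3) |M| ⟨
    length M ℕ.* 3                      ≡⟨ length-concatMap optionsAt 3 length-optionsAt M ⟨
    length options                      ≡⟨ length-split clean? options ⟨
    length clean ℕ.+ length dirty       ≤⟨ ℕₚ.+-monoʳ-≤ (length clean) fewDirty ⟩
    length clean ℕ.+ 6                  ∎)
    where open ℕₚ.≤-Reasoning

winner-2-3 : Winner 2 3 T43
winner-2-3 = step firstHubs (toWitness {a? = valid? 2 [] firstHubs} tt) λ bv₁ valid₁ →
  second bv₁ (proj₁ valid₁)
  where
  pairsApart : AllPairs Disjoint candidatePairs
  pairsApart = toWitness {a? = AllPairs.allPairs? disjoint? candidatePairs} tt
  |xs++[]| : ∀ {n} (xs : List Cell) → length xs ≡ n → length (xs ++ []) ≡ n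
  |xs++[]| xs |xs| = trans (cong length (Listₚ.++-identityʳ xs)) |xs|
  second : ∀ bv₁ → length bv₁ ≡ 3 → Win firstHubs (bv₁ ++ [])
  second bv₁ |bv₁| with find (pigeonhole candidatePairs pairsApart bv₁ (subst (_< 4) (sym |bv₁|) ℕₚ.≤-refl))
  ... | P , P∈ , untouched with All.lookup secondMoves P∈
  ... | size , distinct , unclaimed , good =
    step P (size , distinct , stillUnmarked bv₁ unclaimed untouched (All.tabulate λ _ ())) λ bv₂ valid₂ →
      twelveOptions (P ++ firstHubs) (bv₂ ++ bv₁ ++ []) good
        (trans (Listₚ.length-++ P) (cong (ℕ._+ 2) size))
        (trans (Listₚ.length-++ bv₂) (cong₂ ℕ._+_ (proj₁ valid₂) (|xs++[]| bv₁ |bv₁|)))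

proposition6p5 : IsThreshold T43 1 0 × IsThreshold T43 2 3 × IsThreshold T43 3 8
                   × (∀ (n : ℕ) → n ≥ 4 → InfiniteThreshold T43 n)
proposition6p5 =
  (winner-1-0 , loser-1) , (winner-2-3 , loser-2) , (winner-3-8 , loser-3) , winner-big
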